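{- Let $m \geq 1$, let $k = 2m+3$, and let $G$ be a connected $SC_k$ graph. Then every minimal vertex separator of $G$ has cardinality at most $2$.
   Context: All graphs are finite, simple and undirected. A graph $G$ is an $SC_k$ graph if either $G$ has no cycle, or every induced cycle of $G$ has length exactly $k$. For non-adjacent vertices $u,v$, a set $R \subset V(G)$ is a $(u,v)$-vertex separator if $u$ and $v$ lie in different connected components of $G - R$; it is a minimal $(u,v)$-vertex separator if no proper subset of $R$ is a $(u,v)$-vertex separator. A minimal vertex separator of $G$ is a set that is a minimal $(u,v)$-vertex separator for some pair of non-adjacent vertices $u,v$. -}

module Defs where

open import Data.Nat using (ℕ; zero; suc; _∸_; _≤_)
open import Data.Fin using (Fin; toℕ)
open import Data.Fin.Subset using (Subset; _∈_; _∉_; _⊂_; ⊥)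
open import Data.Product using (Σ; _×_; ∃)
open import Data.Sum using (_⊎_)
open import Relation.Binary.PropositionalEquality using (_≡_; _≢_)
open import Relation.Nullary using (¬_)
open import Function.Definitions using (Injective)
open import Function.Bundles using (_⇔_)

record Graph : Set₁ where
  field
    n      : ℕ
    Adj    : Fin n → Fin n → Set
    sym    : ∀ {u v} → Adj u v → Adj v u
    irrefl : ∀ {u} → ¬ Adj u u

open Graph public

Next : (l : ℕ) → Fin l → Fin l → Set
Next l i j = (suc (toℕ i) ≡ toℕ j) ⊎ ((toℕ i ≡ l ∸ 1) × (toℕ j ≡ 0))

IsCycle : (G : Graph) (l : ℕ) → (Fin l → Fin (n G)) → Set
IsCycle G l c =
  (3 ≤ l) × Injective _≡_ _≡_ c × (∀ i j → Next l i j → Adj G (c i) (c j))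

IsInducedCycle : (G : Graph) (l : ℕ) → (Fin l → Fin (n G)) → Set
IsInducedCycle G l c =
  IsCycle G l c × (∀ i j → Adj G (c i) (c j) ⇔ (Next l i j ⊎ Next l j i))

HasCycle : Graph → Set
HasCycle G = Σ ℕ λ l → Σ (Fin l → Fin (n G)) λ c → IsCycle G l c

SC : ℕ → Graph → Set
SC k G = ¬ HasCycle G
       ⊎ (∀ l (c : Fin l → Fin (n G)) → IsInducedCycle G l c → l ≡ k)

data Reach (G : Graph) (R : Subset (n G)) : Fin (n G) → Fin (n G) → Set where
  here : ∀ {u} → u ∉ R → Reach G R u u
  step : ∀ {u w v} → u ∉ R → Adj G u w → Reach G R w v → Reach G R u v

Connected : Graph → Set
Connected G = ∀ u v → Reach G ⊥ u v

IsSeparator : (G : Graph) → Fin (n G) → Fin (n G) → Subset (n G) → Set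
IsSeparator G u v R = u ∉ R × v ∉ R × ¬ Reach G R u v

IsMinimalSeparator : (G : Graph) → Fin (n G) → Fin (n G) → Subset (n G) → Set
IsMinimalSeparator G u v R =
  IsSeparator G u v R × (∀ R′ → R′ ⊂ R → ¬ IsSeparator G u v R′)

IsMinimalVertexSeparator : (G : Graph) → Subset (n G) → Set
IsMinimalVertexSeparator G S =
  Σ (Fin (n G)) λ u → Σ (Fin (n G)) λ v →
    u ≢ v × ¬ Adj G u v × IsMinimalSeparator G u v S

-- Suppose a minimal (u,v)-separator S has three distinct vertices.  G has
-- no triangle (a triangle is an induced 3-cycle), so two of them, α and γ,
-- are non-adjacent; call the third β.  By minimality every vertex of S has
-- a neighbour in the component C_u of u and in the component C_v of v, so
-- there are induced α–γ paths through C_u and through C_v; glued together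
-- they form an induced cycle Z, of length k.  From β we walk through C_u
-- and through C_v until we first meet a neighbour of Z's C_u-part,
-- resp. C_v-part; this yields an induced "ear" E off Z, both of whose ends
-- attach to Z while its interior sees Z only in α or γ.  Counting cycle
-- lengths shows such an ear cannot exist when k is odd and at least 5.
--
-- Adjacency is not
-- decidable in Defs, but as the goal is ⊥ we may assume it is.

module Submission where

open import Defs
open import Data.Nat using (ℕ; zero; suc; _+_; _*_; _≤_; _<_; z≤n; s≤s; _≤?_)
open import Data.Nat.Properties
  using (+-comm; +-suc; +-cancelˡ-≤; <⇒≱; *-monoʳ-≤; ≤-trans; ≤-refl; ≤-pred; suc-injective; +-cancelˡ-≡; +-cancelʳ-≡;
         +-monoˡ-≤; m≤n+m; ≰⇒>; 1+n≢0)
open import Data.Fin using (Fin; _≟_; toℕ) renaming (zero to fzero; suc to fsuc)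
open import Data.Fin.Subset using (Subset; ∣_∣; inside; outside; _-_)
  renaming (_∈_ to _∈ₛ_; _∉_ to _∉ₛ_; _⊆_ to _⊆ₛ_; _⊂_ to _⊂ₛ_)
open import Data.Fin.Subset.Properties
  using (nonempty?; x∈p⇒p-x⊂p; x∈p∧x≢y⇒x∈p-y; p─⊥≡p; Empty-unique; ∣⊥∣≡0)
open import Data.List using (List; []; _∷_; _++_; reverse; length; [_]; lookup)
open import Data.List.Properties
  using (∷-injective; ++-assoc; unfold-reverse; reverse-++; reverse-involutive; length-++;
         length-reverse; ∷ʳ-injective; ++-identityʳ; ++-conicalʳ)
open import Data.List.Membership.Propositional using (_∈_; _∉_)
open import Data.List.Membership.Propositional.Properties using (∈-++⁺ˡ; ∈-++⁺ʳ; ∈-++⁻; ∈-∃++; ∈-lookup)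
open import Data.List.Relation.Unary.Any using (Any; here; there; any?)
import Data.List.Relation.Unary.Any as Any
open import Data.List.Relation.Unary.Any.Properties using () renaming (reverse⁺ to ∈-reverse⁺; reverse⁻ to ∈-reverse⁻)
open import Data.Vec.Base using (_∷_)
import Data.Vec.Base as Vec
open import Data.Product using (Σ; _×_; _,_; proj₁; proj₂)
open import Data.Sum using (_⊎_; inj₁; inj₂)
open import Data.Nat.Solver using (module +-*-Solver)
open import Data.Empty using (⊥; ⊥-elim)
open import Function.Base using (_∘_)
open import Relation.Nullary using (¬_; Dec; yes; no; ¬¬-excluded-middle)
open import Relation.Binary.PropositionalEquality using (_≡_; _≢_; refl; trans; cong; subst) renaming (sym to esym)
open import Function.Bundles using (_⇔_; mk⇔; Equivalence)

module ListFacts {A : Set} where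

  lastOr : A → List A → A
  lastOr x [] = x
  lastOr x (y ∷ ys) = lastOr y ys

  lastOr-++ : ∀ x xs ys → lastOr x (xs ++ ys) ≡ lastOr (lastOr x xs) ys
  lastOr-++ x [] ys = refl
  lastOr-++ x (y ∷ xs) ys = lastOr-++ y xs ys

  lastOr-snoc : ∀ x xs y → lastOr x (xs ++ [ y ]) ≡ y
  lastOr-snoc x [] y = refl
  lastOr-snoc x (z ∷ xs) y = lastOr-snoc z xs y

  lastOr-∈ : ∀ x xs → lastOr x xs ∈ x ∷ xs
  lastOr-∈ x [] = here refl
  lastOr-∈ x (y ∷ xs) = there (lastOr-∈ y xs)

  lastOr-unique : ∀ x xs i b → x ∷ xs ≡ i ++ [ b ] → lastOr x xs ≡ b
  lastOr-unique x xs [] b refl = refl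
  lastOr-unique x xs (j ∷ i) b eq with ∷-injective eq
  ... | refl , refl = lastOr-snoc x i b

  unsnoc : ∀ x xs → Σ (List A) λ i → x ∷ xs ≡ i ++ [ lastOr x xs ]
  unsnoc x [] = [] , refl
  unsnoc x (y ∷ xs) with unsnoc y xs
  ... | i , eq = x ∷ i , cong (x ∷_) eq

  reverse-head : ∀ x xs → Σ (List A) λ r → reverse (x ∷ xs) ≡ lastOr x xs ∷ r
  reverse-head x xs with unsnoc x xs
  ... | i , eq = reverse i , trans (cong reverse eq) (reverse-++ i [ lastOr x xs ])

  reverse-snoc : ∀ xs (w : A) → reverse (xs ++ [ w ]) ≡ w ∷ reverse xs
  reverse-snoc xs w = reverse-++ xs [ w ]

  between : ∀ (rest : List A) z z' r i → rest ≡ z ∷ r → rest ≡ i ++ [ z' ] → z ≢ z' →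
            Σ (List A) λ ms → rest ≡ z ∷ ms ++ [ z' ]
  between rest z z' [] i e1 e2 zz' = ⊥-elim (zz' (proj₂ (∷ʳ-injective [] i (trans (esym e1) e2))))
  between rest z z' (r0 ∷ r1) i e1 e2 zz' with unsnoc r0 r1
  ... | ms , eqm = ms , trans e1 (cong (z ∷_) (trans eqm (cong (λ x → ms ++ [ x ]) last≡z')))
    where
    last≡z' : lastOr r0 r1 ≡ z'
    last≡z' = proj₂ (∷ʳ-injective (z ∷ ms) i (trans (cong (z ∷_) (esym eqm)) (trans (esym e1) e2)))

  position≤ : ∀ (p : List A) {x q} p' {x' q'} → p ++ x ∷ q ≡ p' ++ x' ∷ q' → x' ∉ p → length p ≤ length p'
  position≤ [] p' eq nin = z≤n
  position≤ (a ∷ p) [] refl nin = ⊥-elim (nin (here refl))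
  position≤ (a ∷ p) (b ∷ p') eq nin = s≤s (position≤ p p' (proj₂ (∷-injective eq)) (λ z → nin (there z)))

  suffix-shorter : ∀ {n} p (x : A) q → length (p ++ x ∷ q) ≤ suc n → length q ≤ n
  suffix-shorter {n} p x q le =
    ≤-pred (≤-trans (s≤s (m≤n+m (length q) (length p))) (subst (_≤ suc n) (trans (length-++ p) (+-suc (length p) (length q))) le))

  snoc≢[] : ∀ (xs : List A) w ys → xs ++ w ∷ ys ≢ []
  snoc≢[] [] w ys ()
  snoc≢[] (x ∷ xs) w ys ()

  witness : ∀ {P : A → Set} {xs} → Any P xs → Σ A λ x → x ∈ xs × P x
  witness (here px) = _ , here refl , px
  witness (there a) with witness a
  ... | x , m , px = x , there m , px

  splitFirst : ∀ {P : A → Set} (d : ∀ x → Dec (P x)) xs → Any P xs →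
    Σ (List A) λ p → Σ A λ x → Σ (List A) λ q → (xs ≡ p ++ x ∷ q) × P x × (∀ {y} → y ∈ p → ¬ P y)
  splitFirst d (x ∷ xs) a with d x
  ... | yes px = [] , x , xs , refl , px , λ ()
  ... | no npx with a
  ...   | here px = ⊥-elim (npx px)
  ...   | there a' with splitFirst d xs a'
  ...     | p , y , q , refl , py , np = x ∷ p , y , q , refl , py , λ { (here refl) → npx ; (there m) → np m }

  splitLast : ∀ {P : A → Set} (d : ∀ x → Dec (P x)) xs → Any P xs →
    Σ (List A) λ p → Σ A λ x → Σ (List A) λ q → (xs ≡ p ++ x ∷ q) × P x × (∀ {y} → y ∈ q → ¬ P y)
  splitLast d (x ∷ xs) a with any? d xs
  ... | yes a' with splitLast d xs a'
  ...   | p , y , q , refl , py , np = x ∷ p , y , q , refl , py , np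
  splitLast d (x ∷ xs) a | no na with a
  ... | here px = [] , x , xs , refl , px , λ m py → na (Any.map (λ { refl → py }) m)
  ... | there a' = ⊥-elim (na a')

  firstOrNone : ∀ {P : A → Set} (d : ∀ x → Dec (P x)) xs →
    (∀ {y} → y ∈ xs → ¬ P y) ⊎
    (Σ (List A) λ p → Σ A λ x → Σ (List A) λ q → (xs ≡ p ++ x ∷ q) × P x × (∀ {y} → y ∈ p → ¬ P y))
  firstOrNone d xs with any? d xs
  ... | yes a = inj₂ (splitFirst d xs a)
  ... | no na = inj₁ (λ m py → na (Any.map (λ { refl → py }) m))

open ListFacts public

-- Cycle-length arithmetic for a vertex w off Z with two neighbours on Z:
-- the two cycles through w (of lengths 3 + a and 3 + b) and Z itself
-- (of length c + b + 2, where c ≥ a) all have length k, forcing k ≤ 4.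
twoChordsBound : ∀ a b c k → 3 + a ≡ k → 3 + b ≡ k → suc (c + suc b) ≡ k → a ≤ c → k ≤ 4
twoChordsBound a b c .(3 + a) refl b-cycle whole a≤c = s≤s (s≤s (s≤s a≤1))
  where
  b≡a : b ≡ a
  b≡a = +-cancelˡ-≡ 3 b a b-cycle
  bound : suc (a + suc a) ≤ 3 + a
  bound = subst (suc (a + suc a) ≤_) (subst (λ t → suc (c + suc t) ≡ 3 + a) b≡a whole)
                (s≤s (+-monoˡ-≤ (suc a) a≤c))
  a≤1 : a ≤ 1
  a≤1 = ≤-pred (≤-pred (+-cancelˡ-≤ a (2 + a) 3
          (subst (_≤ a + 3) (esym (+-suc a (suc a))) (subst (suc (a + suc a) ≤_) (+-comm 3 a) bound))))

-- Cycle-length arithmetic for an ear of d vertices between two vertices of Z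
-- splitting it into arcs with p and q inner vertices: the two new cycles and
-- Z all have length k, forcing k to be even.
earLengthEven : ∀ d p q k → suc (suc (d + p)) ≡ k → suc (suc (d + q)) ≡ k → suc (p + suc q) ≡ k →
                k ≡ suc d + suc d
earLengthEven d p q k first second whole = trans (esym first) (cong suc (trans (cong (λ t → suc (d + t)) (esym d≡p)) (esym (+-suc d d))))
  where
  p≡q : p ≡ q
  p≡q = +-cancelˡ-≡ d p q (suc-injective (suc-injective (trans first (esym second))))
  whole′ : suc (suc (p + p)) ≡ k
  whole′ = trans (cong suc (trans (esym (+-suc p p)) (cong (λ t → p + suc t) p≡q))) whole
  d≡p : d ≡ p
  d≡p = +-cancelʳ-≡ p d p (suc-injective (suc-injective (trans first (esym whole′))))

odd≢even : ∀ a b → suc (a + a) ≢ b + b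
odd≢even zero zero ()
odd≢even zero (suc b) e with trans (suc-injective e) (+-suc b b)
... | ()
odd≢even (suc a) zero ()
odd≢even (suc a) (suc b) e = odd≢even a b (suc-injective (trans (esym (+-suc (suc a) a)) (trans (suc-injective e) (+-suc b b))))

2m+3-odd : ∀ m r → 2 * m + 3 ≢ r + r
2m+3-odd m r e = odd≢even (suc m) r (trans (esym (2m+3≡ m)) e)
  where
  open +-*-Solver
  2m+3≡ : ∀ m → 2 * m + 3 ≡ suc (suc m + suc m)
  2m+3≡ = solve 1 (λ m → con 2 :* m :+ con 3 := con 1 :+ ((con 1 :+ m) :+ (con 1 :+ m))) refl

5≤2m+3 : ∀ m → 1 ≤ m → 5 ≤ 2 * m + 3
5≤2m+3 m 1≤m = +-monoˡ-≤ 3 (*-monoʳ-≤ 2 1≤m)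

x∉p-x : ∀ {n} (p : Subset n) x → x ∉ₛ p - x
x∉p-x (b ∷ p) fzero ()
x∉p-x (b ∷ p) (fsuc x) (Vec.there m) = x∉p-x p x m

∣p∣≤1+∣p-x∣ : ∀ {n} (p : Subset n) x → ∣ p ∣ ≤ suc ∣ p - x ∣
∣p∣≤1+∣p-x∣ (inside ∷ p) fzero = s≤s (subst (λ q → ∣ p ∣ ≤ ∣ q ∣) (esym (p─⊥≡p p)) ≤-refl)
∣p∣≤1+∣p-x∣ (outside ∷ p) fzero = subst (λ q → ∣ p ∣ ≤ suc ∣ q ∣) (esym (p─⊥≡p p)) (m≤n+m ∣ p ∣ 1)
∣p∣≤1+∣p-x∣ (inside ∷ p) (fsuc x) = s≤s (∣p∣≤1+∣p-x∣ p x)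
∣p∣≤1+∣p-x∣ (outside ∷ p) (fsuc x) = ∣p∣≤1+∣p-x∣ p x

∣p-x∣-lower : ∀ {n k} (p : Subset n) x → suc k ≤ ∣ p ∣ → k ≤ ∣ p - x ∣
∣p-x∣-lower p x le = ≤-pred (≤-trans le (∣p∣≤1+∣p-x∣ p x))

element : ∀ {n} (p : Subset n) → 1 ≤ ∣ p ∣ → Σ (Fin n) (_∈ₛ p)
element {n} p 1≤∣p∣ with nonempty? p
... | yes ne = ne
... | no empty with subst (1 ≤_) (trans (cong ∣_∣ (Empty-unique empty)) (∣⊥∣≡0 n)) 1≤∣p∣
...   | ()

threeElements : ∀ {n} (p : Subset n) → 3 ≤ ∣ p ∣ → Σ (Fin n) λ a → Σ (Fin n) λ b → Σ (Fin n) λ c →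
  a ∈ₛ p × b ∈ₛ p × c ∈ₛ p × a ≢ b × b ≢ c × a ≢ c
threeElements p 3≤∣p∣ with element p (≤-trans (s≤s z≤n) 3≤∣p∣)
... | a , a∈p with element (p - a) (≤-trans (s≤s z≤n) (∣p-x∣-lower p a 3≤∣p∣))
... | b , b∈p-a with element (p - a - b) (∣p-x∣-lower (p - a) b (∣p-x∣-lower p a 3≤∣p∣))
... | c , c∈p-a-b = a , b , c , a∈p , b∈p , c∈p ,
      (λ { refl → x∉p-x p a b∈p-a }) , (λ { refl → x∉p-x (p - a) b c∈p-a-b }) , (λ { refl → x∉p-x p a c∈p-a })
  where
  c∈p-a : c ∈ₛ p - a
  c∈p-a = proj₁ (x∈p⇒p-x⊂p b∈p-a) c∈p-a-b
  b∈p : b ∈ₛ p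
  b∈p = proj₁ (x∈p⇒p-x⊂p a∈p) b∈p-a
  c∈p : c ∈ₛ p
  c∈p = proj₁ (x∈p⇒p-x⊂p a∈p) c∈p-a

-- Induced paths and induced cycles of a graph, represented by lists of vertices.
module Paths (G : Graph) where

  V : Set
  V = Fin (n G)

  _~_ : V → V → Set
  x ~ y = Adj G x y

  ~sym : ∀ {x y} → x ~ y → y ~ x
  ~sym = Graph.sym G

  ~irr : ∀ {x} → ¬ x ~ x
  ~irr = irrefl G

  ~≢ : ∀ {x y} → x ~ y → x ≢ y
  ~≢ a refl = ~irr a

  data IP : List V → Set where
    ip0 : IP []
    ip1 : ∀ x → IP (x ∷ [])
    ipc : ∀ {x y ys} → x ~ y → (∀ {z} → z ∈ ys → ¬ x ~ z) → x ∉ y ∷ ys → IP (y ∷ ys) → IP (x ∷ y ∷ ys)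

  ip-tail : ∀ {x xs} → IP (x ∷ xs) → IP xs
  ip-tail (ip1 x) = ip0
  ip-tail (ipc _ _ _ p) = p

  ip-notin : ∀ {x xs} → IP (x ∷ xs) → x ∉ xs
  ip-notin (ip1 x) ()
  ip-notin (ipc _ _ n _) = n

  ip-head : ∀ {x y xs} → IP (x ∷ y ∷ xs) → x ~ y
  ip-head (ipc a _ _ _) = a

  ip-far : ∀ {x y xs z} → IP (x ∷ y ∷ xs) → z ∈ xs → ¬ x ~ z
  ip-far (ipc _ f _ _) = f

  ip-suffix : ∀ xs {ys} → IP (xs ++ ys) → IP ys
  ip-suffix [] p = p
  ip-suffix (x ∷ xs) p = ip-suffix xs (ip-tail p)

  ip-prefix : ∀ xs {ys} → IP (xs ++ ys) → IP xs
  ip-prefix [] p = ip0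
  ip-prefix (x ∷ []) p = ip1 x
  ip-prefix (x ∷ y ∷ xs) (ipc a f ni p) = ipc a (λ z → f (∈-++⁺ˡ z)) (λ z → ni (∈-++⁺ˡ z)) (ip-prefix (y ∷ xs) p)

  ip-disj : ∀ xs {ys z} → IP (xs ++ ys) → z ∈ xs → z ∈ ys → ⊥
  ip-disj (x ∷ xs) p (here refl) q = ip-notin p (∈-++⁺ʳ xs q)
  ip-disj (x ∷ xs) p (there m) q = ip-disj xs (ip-tail p) m q

  ip-glue : ∀ xs x ys → IP (xs ++ [ x ]) → IP (x ∷ ys) → (∀ {p q} → p ∈ xs → q ∈ ys → ¬ p ~ q) → (∀ {p} → p ∈ xs → p ∉ ys) → IP (xs ++ x ∷ ys)
  ip-glue [] x ys _ q _ _ = q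
  ip-glue (p ∷ []) x ys (ipc a _ ni _) q ne nd = ipc a (λ z → ne (here refl) z) nii q
    where
    nii : p ∉ x ∷ ys
    nii (here e) = ni (here e)
    nii (there m) = nd (here refl) m
  ip-glue (p ∷ p' ∷ xs) x ys (ipc a f ni r) q ne nd = ipc a nn nii (ip-glue (p' ∷ xs) x ys r q (λ m → ne (there m)) (λ m → nd (there m)))
    where
    nn : ∀ {z} → z ∈ xs ++ x ∷ ys → ¬ p ~ z
    nn m with ∈-++⁻ xs m
    ... | inj₁ m1 = f (∈-++⁺ˡ m1)
    ... | inj₂ (here refl) = f (∈-++⁺ʳ xs (here refl))
    ... | inj₂ (there m2) = ne (here refl) m2
    nii : p ∉ p' ∷ xs ++ x ∷ ys
    nii (here e) = ni (here e)
    nii (there m) with ∈-++⁻ xs m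
    ... | inj₁ m1 = ni (there (∈-++⁺ˡ m1))
    ... | inj₂ (here e) = ni (there (∈-++⁺ʳ xs (here e)))
    ... | inj₂ (there m2) = nd (here refl) m2

  ip-snoc : ∀ xs y x → IP (xs ++ [ y ]) → y ~ x → (∀ {p} → p ∈ xs → ¬ p ~ x) → x ∉ xs ++ [ y ] → IP ((xs ++ [ y ]) ++ [ x ])
  ip-snoc xs y x P yx nx xn = subst IP (esym (++-assoc xs [ y ] [ x ])) (ip-glue xs y [ x ] P (ipc yx (λ ()) yn (ip1 x)) ne nd)
    where
    yn : y ∉ [ x ]
    yn (here e) = ~≢ yx e
    ne : ∀ {p q} → p ∈ xs → q ∈ [ x ] → ¬ p ~ q
    ne m (here refl) = nx m
    nd : ∀ {p} → p ∈ xs → p ∉ [ x ]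
    nd m (here refl) = xn (∈-++⁺ˡ m)

  ip-rev : ∀ xs → IP xs → IP (reverse xs)
  ip-rev [] _ = ip0
  ip-rev (x ∷ []) _ = ip1 x
  ip-rev (x ∷ y ∷ ys) (ipc a f ni p) = subst IP (esym e) (ip-snoc (reverse ys) y x IH (~sym a) nx xn)
    where
    IH : IP (reverse ys ++ [ y ])
    IH = subst IP (unfold-reverse y ys) (ip-rev (y ∷ ys) p)
    e : reverse (x ∷ y ∷ ys) ≡ (reverse ys ++ [ y ]) ++ [ x ]
    e = trans (unfold-reverse x (y ∷ ys)) (cong (_++ [ x ]) (unfold-reverse y ys))
    nx : ∀ {p} → p ∈ reverse ys → ¬ p ~ x
    nx m pa = f (∈-reverse⁻ m) (~sym pa)
    xn : x ∉ reverse ys ++ [ y ]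
    xn m with ∈-++⁻ (reverse ys) m
    ... | inj₁ m1 = ni (there (∈-reverse⁻ m1))
    ... | inj₂ (here e) = ni (here e)

  -- CycP x P w: x ∷ P ++ [ w ] is an induced cycle (closed through the edge
  -- x ~ w).  Cycles are lists of vertices up to rotation and reversal.
  record CycP (x : V) (P : List V) (w : V) : Set where
    field
      ipx : IP (x ∷ P)
      ipw : IP (P ++ [ w ])
      xw : x ~ w
      x≢w : x ≢ w
      ne : P ≢ []

  Cyc : List V → Set
  Cyc zs = Σ V λ x → Σ (List V) λ P → Σ V λ w → (zs ≡ x ∷ P ++ [ w ]) × CycP x P w

  cycP-notin : ∀ {x P w} → CycP x P w → x ∉ P ++ [ w ]
  cycP-notin {x} {P} {w} c m with ∈-++⁻ P m
  ... | inj₁ m1 = ip-notin (CycP.ipx c) m1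
  ... | inj₂ (here e) = CycP.x≢w c e

  cyc-rot1 : ∀ x xs → Cyc (x ∷ xs) → Cyc (xs ++ [ x ])
  cyc-rot1 x xs (x' , [] , w , eq , c) = ⊥-elim (CycP.ne c refl)
  cyc-rot1 x xs (x' , y ∷ ms , w , eq , c) with ∷-injective eq
  ... | refl , refl = y , ms ++ [ w ] , x , refl , record
      { ipx = CycP.ipw c
      ; ipw = ip-snoc ms w x (ip-tail (CycP.ipw c)) (~sym (CycP.xw c)) nx xn
      ; xw = ~sym (ip-head (CycP.ipx c))
      ; x≢w = λ e → ip-notin (CycP.ipx c) (here (esym e))
      ; ne = snoc≢[] ms w [] }
    where
    nx : ∀ {p} → p ∈ ms → ¬ p ~ x
    nx m pa = ip-far (CycP.ipx c) m (~sym pa)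
    xn : x ∉ ms ++ [ w ]
    xn m = cycP-notin c (there m)

  cyc-rot : ∀ p q → Cyc (p ++ q) → Cyc (q ++ p)
  cyc-rot [] q c = subst Cyc (esym (++-identityʳ q)) c
  cyc-rot (a ∷ p) q c = subst Cyc (++-assoc q [ a ] p) (cyc-rot p (q ++ [ a ]) (subst Cyc (++-assoc p q [ a ]) (cyc-rot1 a (p ++ q) c)))

  cyc-front : ∀ zs α → Cyc zs → α ∈ zs → Σ (List V) λ rest → Cyc (α ∷ rest) × (∀ {v} → v ∈ rest → v ∈ zs) × (suc (length rest) ≡ length zs) × (∀ {v} → v ∈ zs → v ∈ α ∷ rest)
  cyc-front zs α c m with ∈-∃++ m
  ... | p , q , refl = q ++ p , cyc-rot p (α ∷ q) c , mem , len , mem2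
    where
    mem2 : ∀ {v} → v ∈ p ++ α ∷ q → v ∈ α ∷ q ++ p
    mem2 m' with ∈-++⁻ p m'
    ... | inj₁ m1 = there (∈-++⁺ʳ q m1)
    ... | inj₂ (here e) = here e
    ... | inj₂ (there m2) = there (∈-++⁺ˡ m2)
    mem : ∀ {v} → v ∈ q ++ p → v ∈ p ++ α ∷ q
    mem m' with ∈-++⁻ q m'
    ... | inj₁ m1 = ∈-++⁺ʳ p (there m1)
    ... | inj₂ m2 = ∈-++⁺ˡ m2
    len : suc (length (q ++ p)) ≡ length (p ++ α ∷ q)
    len = trans (cong suc (trans (length-++ q) (+-comm (length q) (length p)))) (trans (esym (+-suc (length p) (length q))) (esym (length-++ p)))

  cyc-rev : ∀ α rest → Cyc (α ∷ rest) → Cyc (α ∷ reverse rest)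
  cyc-rev α rest (x' , [] , w , eq , c) = ⊥-elim (CycP.ne c refl)
  cyc-rev α rest (x' , y ∷ ms , w , eq , c) with ∷-injective eq
  ... | refl , refl = α , w ∷ reverse ms , y , eqn , record
      { ipx = ipc (CycP.xw c) (λ m → ip-far (CycP.ipx c) (∈-reverse⁻ m)) xn ipW
      ; ipw = subst IP eqr (ip-rev _ (CycP.ipw c))
      ; xw = ip-head (CycP.ipx c)
      ; x≢w = λ e → ip-notin (CycP.ipx c) (here e)
      ; ne = λ () }
    where
    eqr : reverse (y ∷ ms ++ [ w ]) ≡ (w ∷ reverse ms) ++ [ y ]
    eqr = trans (unfold-reverse y (ms ++ [ w ])) (cong (_++ [ y ]) (reverse-snoc ms w))
    eqn : α ∷ reverse (y ∷ ms ++ [ w ]) ≡ α ∷ (w ∷ reverse ms) ++ [ y ]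
    eqn = cong (α ∷_) eqr
    ipW : IP (w ∷ reverse ms)
    ipW = subst IP (reverse-snoc ms w) (ip-rev _ (ip-tail (CycP.ipw c)))
    xn : α ∉ w ∷ reverse ms
    xn (here e) = CycP.x≢w c e
    xn (there m) = ip-notin (CycP.ipx c) (there (∈-reverse⁻ m))

  cyc-adj : ∀ α rest z → Cyc (α ∷ rest) → z ∈ rest → α ~ z → (Σ (List V) λ r → rest ≡ z ∷ r) ⊎ (Σ (List V) λ i → rest ≡ i ++ [ z ])
  cyc-adj α rest z (x' , [] , w , eq , c) m a = ⊥-elim (CycP.ne c refl)
  cyc-adj α rest z (x' , y ∷ ms , w , eq , c) m a with ∷-injective eq
  ... | refl , refl with m
  ... | here refl = inj₁ (ms ++ [ w ] , refl)
  ... | there m' with ∈-++⁻ ms m'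
  ... | inj₁ m1 = ⊥-elim (ip-far (CycP.ipx c) m1 a)
  ... | inj₂ (here refl) = inj₂ (y ∷ ms , refl)

  arcPre : ∀ α rest p β q → Cyc (α ∷ rest) → rest ≡ p ++ β ∷ q → ¬ α ~ β → IP (α ∷ p ++ [ β ])
  arcPre α rest p β q (x' , P , w , eq , c) e nab with ∷-injective eq
  ... | refl , e2 with q
  ... | [] with ∷ʳ-injective p P (trans (esym e) e2)
  ...   | _ , refl = ⊥-elim (nab (CycP.xw c))
  arcPre α rest p β q (x' , P , w , eq , c) e nab | refl , e2 | q₀ ∷ q₁ with unsnoc q₀ q₁
  ... | i , eqi with ∷ʳ-injective (p ++ β ∷ i) P (trans (++-assoc p (β ∷ i) _) (trans (cong (λ t → p ++ β ∷ t) (esym eqi)) (trans (esym e) e2)))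
  ... | refl , _ = ip-prefix (α ∷ p ++ [ β ]) (subst IP (cong (α ∷_) (esym (++-assoc p [ β ] i))) (CycP.ipx c))

  arcSuf : ∀ α rest p β q → Cyc (α ∷ rest) → rest ≡ p ++ β ∷ q → ¬ α ~ β → IP (β ∷ q ++ [ α ])
  arcSuf α rest p β q c e nab = subst IP e2 (ip-rev _ (arcPre α (reverse rest) (reverse q) β (reverse p) (cyc-rev α rest c) e1 nab))
    where
    e1 : reverse rest ≡ reverse q ++ β ∷ reverse p
    e1 = trans (cong reverse e) (trans (reverse-++ p (β ∷ q)) (trans (cong (_++ reverse p) (unfold-reverse β q)) (++-assoc (reverse q) [ β ] (reverse p))))
    e2 : reverse (α ∷ reverse q ++ [ β ]) ≡ β ∷ q ++ [ α ]
    e2 = trans (unfold-reverse α (reverse q ++ [ β ])) (cong (_++ [ α ]) (trans (reverse-snoc (reverse q) β) (cong (β ∷_) (reverse-involutive q))))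

  cyc2 : ∀ α A β B → IP (α ∷ A ++ [ β ]) → IP (α ∷ B ++ [ β ]) → A ≢ [] → B ≢ [] → ¬ α ~ β →
         (∀ {p q} → p ∈ A → q ∈ B → ¬ p ~ q) → (∀ {p} → p ∈ A → p ∉ B) → Cyc (α ∷ A ++ β ∷ reverse B)
  cyc2 α A β [] IA IB neA neB nab ne nd = ⊥-elim (neB refl)
  cyc2 α A β (b0 ∷ B1) IA IB neA neB nab ne nd = α , A ++ β ∷ reverse B1 , b0 , eqz , record
      { ipx = ip-glue (α ∷ A) β (reverse B1) IA IPB' ne1 nd1
      ; ipw = subst IP (esym (++-assoc A (β ∷ reverse B1) [ b0 ])) (ip-glue A β (reverse B1 ++ [ b0 ]) (ip-tail IA) IPB ne2 nd2)
      ; xw = ip-head IB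
      ; x≢w = λ e → ip-notin IB (here e)
      ; ne = ne3 }
    where
    eqz : α ∷ A ++ β ∷ reverse (b0 ∷ B1) ≡ α ∷ (A ++ β ∷ reverse B1) ++ [ b0 ]
    eqz = cong (α ∷_) (trans (cong (λ t → A ++ β ∷ t) (unfold-reverse b0 B1)) (esym (++-assoc A (β ∷ reverse B1) [ b0 ])))
    IPB' : IP (β ∷ reverse B1)
    IPB' = subst IP (reverse-snoc B1 β) (ip-rev _ (ip-suffix (α ∷ b0 ∷ []) IB))
    IPB : IP (β ∷ reverse B1 ++ [ b0 ])
    IPB = subst IP (trans (reverse-snoc (b0 ∷ B1) β) (cong (β ∷_) (unfold-reverse b0 B1))) (ip-rev _ (ip-tail IB))
    ne1 : ∀ {p q} → p ∈ α ∷ A → q ∈ reverse B1 → ¬ p ~ q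
    ne1 (here refl) m = ip-far IB (∈-++⁺ˡ (∈-reverse⁻ {xs = B1} m))
    ne1 (there m1) m = ne m1 (there (∈-reverse⁻ m))
    nd1 : ∀ {p} → p ∈ α ∷ A → p ∉ reverse B1
    nd1 (here refl) m = ip-notin IB (there (∈-++⁺ˡ (∈-reverse⁻ {xs = B1} m)))
    nd1 (there m1) m = nd m1 (there (∈-reverse⁻ m))
    ne2 : ∀ {p q} → p ∈ A → q ∈ reverse B1 ++ [ b0 ] → ¬ p ~ q
    ne2 m1 m with ∈-++⁻ (reverse B1) m
    ... | inj₁ m2 = ne m1 (there (∈-reverse⁻ m2))
    ... | inj₂ (here refl) = ne m1 (here refl)
    nd2 : ∀ {p} → p ∈ A → p ∉ reverse B1 ++ [ b0 ]
    nd2 m1 m with ∈-++⁻ (reverse B1) m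
    ... | inj₁ m2 = nd m1 (there (∈-reverse⁻ m2))
    ... | inj₂ (here refl) = nd m1 (here refl)
    ne3 : A ++ β ∷ reverse B1 ≢ []
    ne3 = snoc≢[] A β (reverse B1)

  cyc2-len : ∀ (α : V) A (β : V) (B : List V) → length (α ∷ A ++ β ∷ reverse B) ≡ suc (suc (length A + length B))
  cyc2-len α A β B = cong suc (trans (length-++ A) (trans (+-suc (length A) _) (cong (λ t → suc (length A + t)) (length-reverse B))))

  cyc-ip : ∀ α rest → Cyc (α ∷ rest) → IP rest × α ∉ rest
  cyc-ip α rest (x' , P , w , eq , c) with ∷-injective eq
  ... | refl , refl = CycP.ipw c , cycP-notin c

-- List cycles are induced cycles in the sense of Defs.
module ListCycles (G : Graph) where
  open Paths G

  lookup-snoc : ∀ (ms : List V) w (j : Fin (length (ms ++ [ w ]))) → (toℕ j ≡ length ms × lookup (ms ++ [ w ]) j ≡ w) ⊎ (suc (toℕ j) ≤ length ms × lookup (ms ++ [ w ]) j ∈ ms)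
  lookup-snoc [] w fzero = inj₁ (refl , refl)
  lookup-snoc (m ∷ ms) w fzero = inj₂ (s≤s z≤n , here refl)
  lookup-snoc (m ∷ ms) w (fsuc j) with lookup-snoc ms w j
  ... | inj₁ (e1 , e2) = inj₁ (cong suc e1 , e2)
  ... | inj₂ (l , m') = inj₂ (s≤s l , there m')

  ip-pos : ∀ {xs} → IP xs → ∀ i j → lookup xs i ~ lookup xs j ⇔ (suc (toℕ i) ≡ toℕ j ⊎ suc (toℕ j) ≡ toℕ i)
  ip-pos (ip1 x) fzero fzero = mk⇔ (λ a → ⊥-elim (~irr a)) λ { (inj₁ ()) ; (inj₂ ()) }
  ip-pos (ipc xy far ni r) fzero fzero = mk⇔ (λ a → ⊥-elim (~irr a)) λ { (inj₁ ()) ; (inj₂ ()) }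
  ip-pos (ipc xy far ni r) fzero (fsuc fzero) = mk⇔ (λ _ → inj₁ refl) (λ _ → xy)
  ip-pos {x ∷ y ∷ ys} (ipc xy far ni r) fzero (fsuc (fsuc j)) = mk⇔ (λ a → ⊥-elim (far (∈-lookup j) a)) λ { (inj₁ ()) ; (inj₂ ()) }
  ip-pos (ipc xy far ni r) (fsuc fzero) fzero = mk⇔ (λ _ → inj₂ refl) (λ _ → ~sym xy)
  ip-pos {x ∷ y ∷ ys} (ipc xy far ni r) (fsuc (fsuc i)) fzero = mk⇔ (λ a → ⊥-elim (far (∈-lookup i) (~sym a))) λ { (inj₁ ()) ; (inj₂ ()) }
  ip-pos (ipc xy far ni r) (fsuc i) (fsuc j) = mk⇔
    (λ a → f (Equivalence.to (ip-pos r i j) a))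
    (λ h → Equivalence.from (ip-pos r i j) (g h))
    where
    f : suc (toℕ i) ≡ toℕ j ⊎ suc (toℕ j) ≡ toℕ i → suc (suc (toℕ i)) ≡ suc (toℕ j) ⊎ suc (suc (toℕ j)) ≡ suc (toℕ i)
    f (inj₁ e) = inj₁ (cong suc e)
    f (inj₂ e) = inj₂ (cong suc e)
    g : suc (suc (toℕ i)) ≡ suc (toℕ j) ⊎ suc (suc (toℕ j)) ≡ suc (toℕ i) → suc (toℕ i) ≡ toℕ j ⊎ suc (toℕ j) ≡ toℕ i
    g (inj₁ e) = inj₁ (suc-injective e)
    g (inj₂ e) = inj₂ (suc-injective e)

  ip-inj : ∀ {xs} → IP xs → ∀ i j → lookup xs i ≡ lookup xs j → i ≡ j
  ip-inj (ip1 x) fzero fzero e = refl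
  ip-inj (ipc xy far ni r) fzero fzero e = refl
  ip-inj {x ∷ xs} (ipc xy far ni r) fzero (fsuc j) e = ⊥-elim (ni (subst (_∈ xs) (esym e) (∈-lookup j)))
  ip-inj {x ∷ xs} (ipc xy far ni r) (fsuc i) fzero e = ⊥-elim (ni (subst (_∈ xs) e (∈-lookup i)))
  ip-inj (ipc xy far ni r) (fsuc i) (fsuc j) e = cong fsuc (ip-inj r i j e)

  module AsInducedCycle (x y w : V) (ms : List V) (c : CycP x (y ∷ ms) w) where
    Q : List V
    Q = y ∷ ms ++ [ w ]
    lQ : length Q ≡ suc (length ms + 1)
    lQ = cong suc (length-++ ms)

    front-adj : ∀ j → x ~ lookup Q j ⇔ (toℕ j ≡ 0 ⊎ suc (toℕ j) ≡ length Q)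
    front-adj fzero = mk⇔ (λ _ → inj₁ refl) (λ _ → ip-head (CycP.ipx c))
    front-adj (fsuc j) with lookup-snoc ms w j
    ... | inj₁ (e1 , e2) = mk⇔ (λ _ → inj₂ (cong suc (trans (cong suc e1) (trans (+-comm 1 (length ms)) (esym (length-++ ms)))))) (λ _ → subst (x ~_) (esym e2) (CycP.xw c))
    ... | inj₂ (lt , m) = mk⇔ (λ a → ⊥-elim (ip-far (CycP.ipx c) m a)) fr
      where
      fr : toℕ (fsuc j) ≡ 0 ⊎ suc (toℕ (fsuc j)) ≡ length Q → x ~ lookup Q (fsuc j)
      fr (inj₁ ())
      fr (inj₂ e) = ⊥-elim (noLe lt (suc-injective (trans (suc-injective (trans e lQ)) (+-comm (length ms) 1))))
        where
        noLe : ∀ {a b} → suc a ≤ b → a ≡ b → ⊥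
        noLe {suc a} (s≤s l) refl = noLe l refl

    l : ℕ
    l = suc (length Q)

    vertex : Fin l → V
    vertex = lookup (x ∷ Q)

    adjIff : ∀ i j → Adj G (vertex i) (vertex j) ⇔ (Next l i j ⊎ Next l j i)
    adjIff fzero fzero = mk⇔ (λ a → ⊥-elim (~irr a)) fr
      where
      fr : Next l fzero fzero ⊎ Next l fzero fzero → Adj G x x
      fr (inj₁ (inj₂ (() , _)))
      fr (inj₂ (inj₂ (() , _)))
    adjIff fzero (fsuc j) = mk⇔ to fr
      where
      F : x ~ lookup Q j ⇔ (toℕ j ≡ 0 ⊎ suc (toℕ j) ≡ length Q)
      F = front-adj j
      to : x ~ lookup Q j → Next l fzero (fsuc j) ⊎ Next l (fsuc j) fzero
      to a with Equivalence.to F a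
      ... | inj₁ e = inj₁ (inj₁ (cong suc (esym e)))
      ... | inj₂ e = inj₂ (inj₂ (e , refl))
      fr : Next l fzero (fsuc j) ⊎ Next l (fsuc j) fzero → x ~ lookup Q j
      fr (inj₁ (inj₁ e)) = Equivalence.from F (inj₁ (esym (suc-injective e)))
      fr (inj₂ (inj₂ (e , _))) = Equivalence.from F (inj₂ e)
    adjIff (fsuc i) fzero = mk⇔ to fr
      where
      F : x ~ lookup Q i ⇔ (toℕ i ≡ 0 ⊎ suc (toℕ i) ≡ length Q)
      F = front-adj i
      to : lookup Q i ~ x → Next l (fsuc i) fzero ⊎ Next l fzero (fsuc i)
      to a with Equivalence.to F (~sym a)
      ... | inj₁ e = inj₂ (inj₁ (cong suc (esym e)))
      ... | inj₂ e = inj₁ (inj₂ (e , refl))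
      fr : Next l (fsuc i) fzero ⊎ Next l fzero (fsuc i) → lookup Q i ~ x
      fr (inj₂ (inj₁ e)) = ~sym (Equivalence.from F (inj₁ (esym (suc-injective e))))
      fr (inj₁ (inj₂ (e , _))) = ~sym (Equivalence.from F (inj₂ e))
    adjIff (fsuc i) (fsuc j) = mk⇔ to fr
      where
      F : lookup Q i ~ lookup Q j ⇔ (suc (toℕ i) ≡ toℕ j ⊎ suc (toℕ j) ≡ toℕ i)
      F = ip-pos (CycP.ipw c) i j
      to : lookup Q i ~ lookup Q j → Next l (fsuc i) (fsuc j) ⊎ Next l (fsuc j) (fsuc i)
      to a with Equivalence.to F a
      ... | inj₁ e = inj₁ (inj₁ (cong suc e))
      ... | inj₂ e = inj₂ (inj₁ (cong suc e))
      fr : Next l (fsuc i) (fsuc j) ⊎ Next l (fsuc j) (fsuc i) → lookup Q i ~ lookup Q j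
      fr (inj₁ (inj₁ e)) = Equivalence.from F (inj₁ (suc-injective e))
      fr (inj₂ (inj₁ e)) = Equivalence.from F (inj₂ (suc-injective e))

    injective : ∀ {i j} → vertex i ≡ vertex j → i ≡ j
    injective {fzero} {fzero} e = refl
    injective {fzero} {fsuc j} e = ⊥-elim (cycP-notin c (subst (_∈ Q) (esym e) (∈-lookup j)))
    injective {fsuc i} {fzero} e = ⊥-elim (cycP-notin c (subst (_∈ Q) e (∈-lookup i)))
    injective {fsuc i} {fsuc j} e = cong fsuc (ip-inj (CycP.ipw c) i j e)

    3≤l : 3 ≤ l
    3≤l = s≤s (s≤s (subst (1 ≤_) (esym (trans (length-++ ms) (+-comm (length ms) 1))) (s≤s z≤n)))

    isInduced : IsInducedCycle G l vertex
    isInduced = (3≤l , injective , λ i j nx → Equivalence.from (adjIff i j) (inj₁ nx)) , adjIff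

  listCycleLength : ∀ k → SC k G → ∀ zs → Cyc zs → length zs ≡ k
  listCycleLength k sc zs (x , [] , w , eq , c) = ⊥-elim (CycP.ne c refl)
  listCycleLength k sc zs (x , y ∷ ms , w , refl , c) with sc
  ... | inj₁ acyclic = ⊥-elim (acyclic (_ , _ , proj₁ isInduced))
    where open AsInducedCycle x y w ms c
  ... | inj₂ allK = allK _ _ isInduced
    where open AsInducedCycle x y w ms c

-- Ears around an induced cycle, in a graph where every induced cycle has
-- the same odd length k ≥ 5 (adjacency being decidable).
module OddCycleGeometry (G : Graph) (dAdj : ∀ x y → Dec (Adj G x y)) (k : ℕ)
  (cycleLength : ∀ zs → Paths.Cyc G zs → length zs ≡ k) (5≤k : 5 ≤ k) (k-odd : ∀ r → k ≢ r + r) where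
  open Paths G

  -- A triangle would be an induced cycle of length 3 < k.
  noTriangle : ∀ {x y z} → x ~ y → y ~ z → x ~ z → ⊥
  noTriangle {x} {y} {z} xy yz xz = <⇒≱ 5≤k (subst (_≤ 4) (cycleLength _ cy) (m≤n+m 3 1))
    where
    cy : Cyc (x ∷ (y ∷ []) ++ [ z ])
    cy = x , y ∷ [] , z , refl , record
      { ipx = ipc xy (λ ()) (λ { (here e) → ~≢ xy e }) (ip1 y)
      ; ipw = ipc yz (λ ()) (λ { (here e) → ~≢ yz e }) (ip1 z)
      ; xw = xz ; x≢w = ~≢ xz ; ne = λ () }

  closeEar : ∀ α e E f β → IP (e ∷ E ++ [ f ]) → e ~ α → f ~ β → ¬ e ~ β → ¬ f ~ α →
            (∀ {x} → x ∈ E → ¬ x ~ α) → (∀ {x} → x ∈ E → ¬ x ~ β) →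
            α ∉ e ∷ E ++ [ f ] → β ∉ e ∷ E ++ [ f ] → ¬ α ~ β →
            IP (α ∷ (e ∷ E ++ [ f ]) ++ [ β ])
  closeEar α e E f β ID eα fβ neβ nfα nEα nEβ αn βn nab =
      ipc (~sym eα) far αn' (ip-snoc (e ∷ E) f β ID fβ nx βn)
    where
    nx : ∀ {p} → p ∈ e ∷ E → ¬ p ~ β
    nx (here refl) = neβ
    nx (there m) = nEβ m
    far : ∀ {z} → z ∈ (E ++ [ f ]) ++ [ β ] → ¬ α ~ z
    far m a with ∈-++⁻ (E ++ [ f ]) m
    ... | inj₂ (here refl) = nab a
    ... | inj₁ m1 with ∈-++⁻ E m1
    ...   | inj₁ m2 = nEα m2 (~sym a)
    ...   | inj₂ (here refl) = nfα (~sym a)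
    αn' : α ∉ e ∷ (E ++ [ f ]) ++ [ β ]
    αn' (here e) = αn (here e)
    αn' (there m) with ∈-++⁻ (E ++ [ f ]) m
    ... | inj₁ m1 = αn (there m1)
    ... | inj₂ (here refl) = neβ eα

  module AroundCycle (Z : List V) (cZ : Cyc Z) where
    SeesOnly : V → V → Set
    SeesOnly x α = ∀ {ζ} → ζ ∈ Z → x ~ ζ → ζ ≡ α

    SeesNothing : V → Set
    SeesNothing x = ∀ {ζ} → ζ ∈ Z → ¬ x ~ ζ

    lengthZ : length Z ≡ k
    lengthZ = cycleLength Z cZ

    -- Walking around
    -- Z from α, let b1 and b2 be the first and last neighbours of w; the
    -- cycles α w b1 … and α w b2 … both have length k, which the arithmetic
    -- of twoChordsBound shows to be impossible.
    module TwoNeighbours {w α β : V} (wn : w ∉ Z) (αZ : α ∈ Z) (βZ : β ∈ Z) (wα : w ~ α) (wβ : w ~ β) where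
      pathVia : ∀ {b} → b ∈ Z → w ~ b → ¬ α ~ b → α ≢ b → IP (α ∷ (w ∷ []) ++ [ b ])
      pathVia {b} bZ wb nab αb = ipc (~sym wα) (λ { (here refl) → nab }) αn (ipc wb (λ ()) (λ { (here e) → wn (subst (_∈ Z) (esym e) bZ) }) (ip1 _))
        where
        αn : α ∉ w ∷ b ∷ []
        αn (here e) = wn (subst (_∈ Z) e αZ)
        αn (there (here e)) = αb e
      sideLength : ∀ {b} B → b ∈ Z → w ~ b → ¬ α ~ b → α ≢ b → IP (α ∷ B ++ [ b ]) → (∀ {q} → q ∈ B → ¬ w ~ q) → (∀ {q} → q ∈ B → q ∈ Z) → suc (suc (suc (length B))) ≡ k
      sideLength [] bZ wb nab αb ip _ _ = ⊥-elim (nab (ip-head ip))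
      sideLength {b} (q ∷ B) bZ wb nab αb ip nw BZ = trans (esym (cyc2-len α (w ∷ []) b (q ∷ B))) (cycleLength _ (cyc2 α (w ∷ []) b (q ∷ B) (pathVia bZ wb nab αb) ip (λ ()) (λ ()) nab ne nd))
        where
        ne : ∀ {p q'} → p ∈ w ∷ [] → q' ∈ q ∷ B → ¬ p ~ q'
        ne (here refl) m = nw m
        nd : ∀ {p} → p ∈ w ∷ [] → p ∉ q ∷ B
        nd (here refl) m = wn (BZ m)

      impossible : α ≢ β → ⊥
      impossible αβ with cyc-front Z α cZ αZ
      ... | rest , c , mem , len , mem2 with mem2 βZ
      ... | here e = αβ (esym e)
      ... | there βr with splitFirst (dAdj w) rest anyr | splitLast (dAdj w) rest anyr
        where
        anyr : Any (w ~_) rest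
        anyr = Any.map (λ e → subst (w ~_) e wβ) βr
      ... | pre , b1 , post , eq1 , wb1 , npre | pre2 , b2 , post2 , eq2 , wb2 , npost =
          <⇒≱ 5≤k (twoChordsBound (length pre) (length post2) (length pre2) k L1 L2 L3 pos)
        where
        αr : α ∉ rest
        αr = proj₂ (cyc-ip α rest c)
        b1r : b1 ∈ rest
        b1r = subst (b1 ∈_) (esym eq1) (∈-++⁺ʳ pre (here refl))
        b2r : b2 ∈ rest
        b2r = subst (b2 ∈_) (esym eq2) (∈-++⁺ʳ pre2 (here refl))
        L1 : 3 + length pre ≡ k
        L1 with dAdj α b1
        ... | yes a = ⊥-elim (noTriangle wα a wb1)
        ... | no nab = sideLength pre (mem b1r) wb1 nab (λ e → αr (subst (_∈ rest) (esym e) b1r)) (arcPre α rest pre b1 post c eq1 nab) npre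
                (λ m → mem (subst (_ ∈_) (esym eq1) (∈-++⁺ˡ m)))
        L2 : 3 + length post2 ≡ k
        L2 with dAdj α b2
        ... | yes a = ⊥-elim (noTriangle wα a wb2)
        ... | no nab = trans (cong (λ t → 3 + t) (esym (length-reverse post2)))
                (sideLength (reverse post2) (mem b2r) wb2 nab (λ e → αr (subst (_∈ rest) (esym e) b2r)) ipR (λ m → npost (∈-reverse⁻ m))
                  (λ m → mem (subst (_ ∈_) (esym eq2) (∈-++⁺ʳ pre2 (there (∈-reverse⁻ m))))))
          where
          eqR : reverse (b2 ∷ post2 ++ [ α ]) ≡ α ∷ reverse post2 ++ [ b2 ]
          eqR = trans (unfold-reverse b2 (post2 ++ [ α ])) (cong (_++ [ b2 ]) (reverse-snoc post2 α))
          ipR : IP (α ∷ reverse post2 ++ [ b2 ])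
          ipR = subst IP eqR (ip-rev _ (arcSuf α rest pre2 b2 post2 c eq2 nab))
        L3 : suc (length pre2 + suc (length post2)) ≡ k
        L3 = trans (cong suc (esym (trans (cong length eq2) (length-++ pre2)))) (trans len lengthZ)
        pos : length pre ≤ length pre2
        pos = position≤ pre pre2 (trans (esym eq1) eq2) (λ m → npre m wb2)

    atMostOneNeighbour : ∀ {w α β} → w ∉ Z → α ∈ Z → β ∈ Z → w ~ α → w ~ β → α ≢ β → ⊥
    atMostOneNeighbour wn αZ βZ wα wβ = TwoNeighbours.impossible wn αZ βZ wα wβ

    seesOnly : ∀ {w α} → w ∉ Z → α ∈ Z → w ~ α → SeesOnly w α
    seesOnly {w} {α} wn αZ wα {ζ} ζZ wζ with ζ ≟ α
    ... | yes e = e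
    ... | no ne = ⊥-elim (atMostOneNeighbour wn αZ ζZ wα wζ (λ e → ne (esym e)))

    earCycleLength : ∀ {α β} e E f B → IP (α ∷ (e ∷ E ++ [ f ]) ++ [ β ]) → IP (α ∷ B ++ [ β ]) → ¬ α ~ β →
      (∀ {x} → x ∈ e ∷ E ++ [ f ] → x ∉ Z) → SeesOnly e α → SeesOnly f β →
      (∀ {x b} → x ∈ E → b ∈ B → ¬ x ~ b) → (∀ {x} → x ∈ B → x ∈ Z) →
      suc (suc (length (e ∷ E ++ [ f ]) + length B)) ≡ k
    earCycleLength e E f [] PD PB nab Dn oe of EB BZ = ⊥-elim (nab (ip-head PB))
    earCycleLength {α} {β} e E f (b ∷ B) PD PB nab Dn oe of EB BZ =
      trans (esym (cyc2-len α D β (b ∷ B))) (cycleLength _ (cyc2 α D β (b ∷ B) PD PB (λ ()) (λ ()) nab ne nd))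
      where
      D : List V
      D = e ∷ E ++ [ f ]
      ne : ∀ {x y} → x ∈ D → y ∈ b ∷ B → ¬ x ~ y
      ne (here refl) m a with oe (BZ m) a
      ... | refl = ip-notin PB (∈-++⁺ˡ m)
      ne (there m1) m a with ∈-++⁻ E m1
      ... | inj₁ m2 = EB m2 m a
      ... | inj₂ (here refl) with of (BZ m) a
      ...   | refl = ip-disj (b ∷ B) (ip-tail PB) m (here refl)
      nd : ∀ {x} → x ∈ D → x ∉ b ∷ B
      nd m m' = Dn m (BZ m')

    -- Together with either arc of Z between α and β, D
    -- forms an induced cycle; both have length k, making k even.
    noEar : ∀ {α β} e E f → IP (e ∷ E ++ [ f ]) → (∀ {x} → x ∈ e ∷ E ++ [ f ] → x ∉ Z) → α ∈ Z → β ∈ Z →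
         e ~ α → f ~ β → SeesOnly e α → SeesOnly f β → (∀ {x} → x ∈ E → SeesNothing x) → α ≢ β → ¬ α ~ β → ⊥
    noEar {α} {β} e E f ID Dn αZ βZ eα fβ oe of EN αβ nab with cyc-front Z α cZ αZ
    ... | rest , c , mem , len , mem2 with mem2 βZ
    ... | here e' = αβ (esym e')
    ... | there βr with ∈-∃++ βr
    ... | p , q , eqr = k-odd (suc (length D)) (earLengthEven (length D) (length p) (length q) k L1 L2 L3)
      where
      D : List V
      D = e ∷ E ++ [ f ]
      PD : IP (α ∷ D ++ [ β ])
      PD = closeEar α e E f β ID eα fβ (λ a → αβ (esym (oe βZ a))) (λ a → αβ (of αZ a)) (λ m → EN m αZ) (λ m → EN m βZ)
             (λ m → Dn m αZ) (λ m → Dn m βZ) nab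
      cycLenB : ∀ B → IP (α ∷ B ++ [ β ]) → (∀ {y} → y ∈ B → y ∈ Z) → suc (suc (length D + length B)) ≡ k
      cycLenB B ip BZ = earCycleLength e E f B PD ip nab Dn oe of (λ m mb a → EN m (BZ mb) a) BZ
      L1 : suc (suc (length D + length p)) ≡ k
      L1 = cycLenB p (arcPre α rest p β q c eqr nab) (λ m → mem (subst (_ ∈_) (esym eqr) (∈-++⁺ˡ m)))
      eqR : reverse (β ∷ q ++ [ α ]) ≡ α ∷ reverse q ++ [ β ]
      eqR = trans (unfold-reverse β (q ++ [ α ])) (cong (_++ [ β ]) (reverse-snoc q α))
      L2 : suc (suc (length D + length q)) ≡ k
      L2 = trans (cong (λ t → suc (suc (length D + t))) (esym (length-reverse q)))
             (cycLenB (reverse q) (subst IP eqR (ip-rev _ (arcSuf α rest p β q c eqr nab)))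
               (λ m → mem (subst (_ ∈_) (esym eqr) (∈-++⁺ʳ p (there (∈-reverse⁻ m))))))
      L3 : suc (length p + suc (length q)) ≡ k
      L3 = trans (cong suc (esym (trans (cong length eqr) (length-++ p)))) (trans len lengthZ)

    -- Here the cycle is written
    -- t ∷ z ∷ ms ++ [ z' ]; then z, D, z', ms is an induced cycle, and its
    -- length k forces |D| = 1, contradicting that D has two ends.
    noTentAt : ∀ {t z z'} rest ms e E f → Cyc (t ∷ rest) → (∀ {v} → v ∈ rest → v ∈ Z) → suc (length rest) ≡ k →
          rest ≡ z ∷ ms ++ [ z' ] → IP (e ∷ E ++ [ f ]) → (∀ {x} → x ∈ e ∷ E ++ [ f ] → x ∉ Z) →
          ¬ z ~ z' → e ~ z → f ~ z' → SeesOnly e z → SeesOnly f z' → (∀ {x} → x ∈ E → SeesOnly x t) → ⊥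
    noTentAt {t} {z} {z'} rest ms e E f c mem len eq ID Dn nzz' ez fz' oe of oE = lenD≢1 lenD
      where
      D : List V
      D = e ∷ E ++ [ f ]
      ipr : IP rest
      ipr = proj₁ (cyc-ip t rest c)
      tr : t ∉ rest
      tr = proj₂ (cyc-ip t rest c)
      arcIP : IP (z ∷ ms ++ [ z' ])
      arcIP = subst IP eq ipr
      inR : ∀ {v} → v ∈ z ∷ ms ++ [ z' ] → v ∈ Z
      inR m = mem (subst (_ ∈_) (esym eq) m)
      zZ : z ∈ Z
      zZ = inR (here refl)
      z'Z : z' ∈ Z
      z'Z = inR (there (∈-++⁺ʳ ms (here refl)))
      zz' : z ≢ z'
      zz' e' = ip-notin arcIP (∈-++⁺ʳ ms (here e'))
      tinR : t ∉ z ∷ ms ++ [ z' ]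
      tinR m = tr (subst (_ ∈_) (esym eq) m)
      earIP : IP (z ∷ D ++ [ z' ])
      earIP = closeEar z e E f z' ID ez fz' (λ a → zz' (esym (oe z'Z a))) (λ a → zz' (of zZ a))
             (λ m a → tinR (subst (_∈ z ∷ ms ++ [ z' ]) (oE m zZ a) (here refl)))
             (λ m a → tinR (subst (_∈ z ∷ ms ++ [ z' ]) (oE m z'Z a) (there (∈-++⁺ʳ ms (here refl)))))
             (λ m → Dn m zZ) (λ m → Dn m z'Z) nzz'
      msZ : ∀ {x} → x ∈ ms → x ∈ Z
      msZ m = inR (there (∈-++⁺ˡ m))
      lenC : suc (suc (length D + length ms)) ≡ k
      lenC = earCycleLength e E f ms earIP arcIP nzz' Dn oe of
               (λ m mb a → tinR (there (∈-++⁺ˡ (subst (_∈ ms) (oE m (msZ mb) a) mb)))) msZ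
      lenZ′ : suc (suc (suc (length ms))) ≡ k
      lenZ′ = trans (cong (suc ∘ suc) (esym (trans (length-++ ms) (+-comm (length ms) 1))))
                    (trans (cong (λ r → suc (length r)) (esym eq)) len)
      lenD : length D ≡ 1
      lenD = +-cancelʳ-≡ (length ms) (length D) 1 (suc-injective (suc-injective (trans lenC (esym lenZ′))))
      lenD≢1 : length D ≢ 1
      lenD≢1 e′ = 1+n≢0 (trans (+-comm 1 (length E)) (trans (esym (length-++ E)) (suc-injective e′)))

    noTent : ∀ {t z z'} e E f → IP (e ∷ E ++ [ f ]) → (∀ {x} → x ∈ e ∷ E ++ [ f ] → x ∉ Z) → t ∈ Z → z ∈ Z → z' ∈ Z →
         z ~ t → z' ~ t → z ≢ z' → ¬ z ~ z' → e ~ z → f ~ z' → SeesOnly e z → SeesOnly f z' → (∀ {x} → x ∈ E → SeesOnly x t) → ⊥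
    noTent {t} {z} {z'} e E f ID Dn tZ zZ z'Z zt z't zz' nzz' ez fz' oe of oE with cyc-front Z t cZ tZ
    ... | rest , c , mem , len , mem2 with mem2 zZ | mem2 z'Z
    ... | here e1 | _ = ~irr (subst (z ~_) (esym e1) zt)
    ... | there _ | here e1 = ~irr (subst (z' ~_) (esym e1) z't)
    ... | there zr | there z'r with cyc-adj t rest z c zr (~sym zt) | cyc-adj t rest z' c z'r (~sym z't)
    ... | inj₁ (r , e1) | inj₁ (r' , e2) = zz' (proj₁ (∷-injective (trans (esym e1) e2)))
    ... | inj₂ (i , e1) | inj₂ (i' , e2) = zz' (proj₂ (∷ʳ-injective i i' (trans (esym e1) e2)))
    ... | inj₁ (r , e1) | inj₂ (i , e2) with between rest z z' r i e1 e2 zz'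
    ...   | ms , eq = noTentAt rest ms e E f c mem (trans len lengthZ) eq ID Dn nzz' ez fz' oe of oE
    noTent {t} {z} {z'} e E f ID Dn tZ zZ z'Z zt z't zz' nzz' ez fz' oe of oE | rest , c , mem , len , mem2 | there zr | there z'r | inj₂ (i , e1) | inj₁ (r , e2) with between rest z' z r i e2 e1 (λ q → zz' (esym q))
    ...   | ms , eq = noTentAt rest ms f (reverse E) e c mem (trans len lengthZ) eq ID' Dn' (λ a → nzz' (~sym a)) fz' ez of oe (λ m → oE (∈-reverse⁻ m))
      where
      eqRev : reverse (e ∷ E ++ [ f ]) ≡ f ∷ reverse E ++ [ e ]
      eqRev = trans (unfold-reverse e (E ++ [ f ])) (cong (_++ [ e ]) (reverse-snoc E f))
      ID' : IP (f ∷ reverse E ++ [ e ])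
      ID' = subst IP eqRev (ip-rev _ ID)
      Dn' : ∀ {x} → x ∈ f ∷ reverse E ++ [ e ] → x ∉ Z
      Dn' m = Dn (∈-reverse⁻ (subst (_ ∈_) (esym eqRev) m))

    splitPath : ∀ d l1 e l2 y → IP (d ∷ (l1 ++ e ∷ l2) ++ [ y ]) → IP (d ∷ l1 ++ [ e ]) × IP (e ∷ l2 ++ [ y ])
    splitPath d l1 e l2 y ip =
      ip-prefix (d ∷ l1 ++ [ e ]) (subst IP (cong (d ∷_) (trans (++-assoc l1 (e ∷ l2) [ y ]) (esym (++-assoc l1 [ e ] (l2 ++ [ y ]))))) ip) ,
      ip-suffix (d ∷ l1) (subst IP (cong (d ∷_) (++-assoc l1 (e ∷ l2) [ y ])) ip)

    splitPath-∈₁ : ∀ (d : V) l1 (e : V) l2 (y : V) {x} → x ∈ d ∷ l1 ++ [ e ] → x ∈ d ∷ (l1 ++ e ∷ l2) ++ [ y ]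
    splitPath-∈₁ d l1 e l2 y (here q) = here q
    splitPath-∈₁ d l1 e l2 y (there m) with ∈-++⁻ l1 m
    ... | inj₁ m1 = there (∈-++⁺ˡ (∈-++⁺ˡ m1))
    ... | inj₂ (here q) = there (∈-++⁺ˡ (∈-++⁺ʳ l1 (here q)))

    splitPath-∈₂ : ∀ (d : V) l1 (e : V) l2 (y : V) {x} → x ∈ e ∷ l2 ++ [ y ] → x ∈ d ∷ (l1 ++ e ∷ l2) ++ [ y ]
    splitPath-∈₂ d l1 e l2 y m = there (subst (_ ∈_) (esym (++-assoc l1 (e ∷ l2) [ y ])) (∈-++⁺ʳ l1 m))

    SeesZ : V → Set
    SeesZ x = Any (x ~_) Z

    seesZ? : ∀ x → Dec (SeesZ x)
    seesZ? x = any? (dAdj x) Z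

    seesNothing : ∀ {x} → ¬ SeesZ x → SeesNothing x
    seesNothing nh ζZ a = nh (Any.map (λ q → subst (_ ~_) q a) ζZ)

    module AvoidingPair (a c : V) (nac : ¬ a ~ c) where
      SeesOnlyPair : V → Set
      SeesOnlyPair x = ∀ {ζ} → ζ ∈ Z → x ~ ζ → ζ ≡ a ⊎ ζ ≡ c

      pair-nonadjacent : ∀ {t t''} → (t ≡ a ⊎ t ≡ c) → (t'' ≡ a ⊎ t'' ≡ c) → t ≢ t'' → ¬ t ~ t''
      pair-nonadjacent (inj₁ refl) (inj₁ refl) ne _ = ne refl
      pair-nonadjacent (inj₁ refl) (inj₂ refl) ne q = nac q
      pair-nonadjacent (inj₂ refl) (inj₁ refl) ne q = nac (~sym q)
      pair-nonadjacent (inj₂ refl) (inj₂ refl) ne _ = ne refl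

      pair-≢ : ∀ {t z'} → (t ≡ a ⊎ t ≡ c) → z' ≢ a → z' ≢ c → t ≢ z'
      pair-≢ (inj₁ refl) za zc q = za (esym q)
      pair-≢ (inj₂ refl) za zc q = zc (esym q)

      -- If d sees only t ∈ {a, c} and the interior L sees only a or c, then
      -- the whole interior sees only t and z' ~ t: scanning L for the first
      -- vertex e that sees Z, the segment d … e is either an ear between a
      -- and c (impossible) or we may continue from e.  The bound n on the
      -- length of L makes the recursion structural.
      scanEar : ∀ {t z'} (n : ℕ) d L y1 → length L ≤ n → IP (d ∷ L ++ [ y1 ]) → (∀ {x} → x ∈ d ∷ L ++ [ y1 ] → x ∉ Z) →
             (t ≡ a ⊎ t ≡ c) → t ∈ Z → d ~ t → SeesOnly d t → y1 ~ z' → SeesOnly y1 z' → z' ∈ Z → z' ≢ a → z' ≢ c →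
             (∀ {x} → x ∈ L → SeesOnlyPair x) → z' ~ t × (∀ {x} → x ∈ L → SeesOnly x t)
      scanEar {t} {z'} n d L y1 le ID Dn tac tZ dt od yz oy z'Z za zc LI with firstOrNone seesZ? L
      ... | inj₁ none with dAdj z' t
      ...   | yes q = q , λ m ζZ a → ⊥-elim (seesNothing (none m) ζZ a)
      ...   | no nq = ⊥-elim (noEar d L y1 ID Dn tZ z'Z dt yz od oy (λ m → seesNothing (none m)) (pair-≢ tac za zc) (λ q → nq (~sym q)))
      scanEar {t} {z'} n d L y1 le ID Dn tac tZ dt od yz oy z'Z za zc LI | inj₂ (l1 , e , l2 , refl , he , nl1) with witness he
      ... | t'' , t''Z , et'' with t'' ≟ t
      ...   | no ne = ⊥-elim (noEar d l1 e (proj₁ (splitPath d l1 e l2 y1 ID)) (λ m → Dn (splitPath-∈₁ d l1 e l2 y1 m)) tZ t''Z dt et'' od oe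
                   (λ m → seesNothing (nl1 m)) (λ q → ne (esym q)) (pair-nonadjacent tac t''ac (λ q → ne (esym q))))
        where
        eZ : e ∉ Z
        eZ = Dn (there (∈-++⁺ˡ (∈-++⁺ʳ l1 (here refl))))
        oe : SeesOnly e t''
        oe = seesOnly eZ t''Z et''
        t''ac : t'' ≡ a ⊎ t'' ≡ c
        t''ac = LI (∈-++⁺ʳ l1 (here refl)) t''Z et''
      scanEar {t} {z'} (suc n) d L y1 le ID Dn tac tZ dt od yz oy z'Z za zc LI | inj₂ (l1 , e , l2 , refl , he , nl1) | t'' , t''Z , et'' | yes refl
        with scanEar n e l2 y1 le' (proj₂ (splitPath d l1 e l2 y1 ID)) (λ m → Dn (splitPath-∈₂ d l1 e l2 y1 m)) tac tZ et'' oe yz oy z'Z za zc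
               (λ m → LI (∈-++⁺ʳ l1 (there m)))
        where
        eZ : e ∉ Z
        eZ = Dn (there (∈-++⁺ˡ (∈-++⁺ʳ l1 (here refl))))
        oe : SeesOnly e t
        oe = seesOnly eZ t''Z et''
        le' : length l2 ≤ n
        le' = suffix-shorter l1 e l2 le
      ... | z't , al2 = z't , all
        where
        all : ∀ {x} → x ∈ l1 ++ e ∷ l2 → SeesOnly x t
        all m ζZ a with ∈-++⁻ l1 m
        ... | inj₁ m1 = ⊥-elim (seesNothing (nl1 m1) ζZ a)
        ... | inj₂ (here refl) = seesOnly (Dn (there (∈-++⁺ˡ (∈-++⁺ʳ l1 (here refl))))) t''Z et'' ζZ a
        ... | inj₂ (there m2) = al2 m2 ζZ a
      scanEar {t} {z'} zero d L y1 le ID Dn tac tZ dt od yz oy z'Z za zc LI | inj₂ (l1 , e , l2 , refl , he , nl1) | t'' , t''Z , et'' | yes refl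
        = ⊥-elim (zle (subst (_≤ 0) (trans (length-++ l1) (+-suc (length l1) (length l2))) le))
        where
        zle : ∀ {m} → ¬ suc m ≤ 0
        zle ()

      -- The main consequence: scan for the first interior vertex e seeing Z,
      -- which sees t ∈ {a, c}.  If z ≁ t, the segment y0 … e is an ear; if
      -- z ~ t, scanEar makes the whole path a tent at t.
      noPairEar : ∀ {z z'} y0 mid y1 → IP (y0 ∷ mid ++ [ y1 ]) → (∀ {x} → x ∈ y0 ∷ mid ++ [ y1 ] → x ∉ Z) → z ∈ Z → z' ∈ Z →
              y0 ~ z → y1 ~ z' → z ≢ z' → ¬ z ~ z' → z ≢ a → z ≢ c → z' ≢ a → z' ≢ c → (∀ {x} → x ∈ mid → SeesOnlyPair x) → ⊥
      noPairEar y0 mid y1 ID Dn zZ z'Z y0z y1z' zz' nzz' za zc z'a z'c MI =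
        noPairEar′ y0 mid y1 ID Dn zZ z'Z y0z y1z' zz' nzz' za zc z'a z'c MI
          (seesOnly (Dn (here refl)) zZ y0z) (seesOnly (Dn (there (∈-++⁺ʳ mid (here refl)))) z'Z y1z')
        where
        noPairEar′ : ∀ {z z'} y0 mid y1 → IP (y0 ∷ mid ++ [ y1 ]) → (∀ {x} → x ∈ y0 ∷ mid ++ [ y1 ] → x ∉ Z) → z ∈ Z → z' ∈ Z →
                y0 ~ z → y1 ~ z' → z ≢ z' → ¬ z ~ z' → z ≢ a → z ≢ c → z' ≢ a → z' ≢ c → (∀ {x} → x ∈ mid → SeesOnlyPair x) →
                SeesOnly y0 z → SeesOnly y1 z' → ⊥
        noPairEar′ {z} {z'} y0 mid y1 ID Dn zZ z'Z y0z y1z' zz' nzz' za zc z'a z'c MI oy0 oy1 with firstOrNone seesZ? mid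
        ... | inj₁ none = noEar y0 mid y1 ID Dn zZ z'Z y0z y1z' oy0 oy1 (λ m → seesNothing (none m)) zz' nzz'
        ... | inj₂ (m1 , e , m2 , refl , he , nm1) with witness he
        ... | t , tZ , et with dAdj z t | MI (∈-++⁺ʳ m1 (here refl)) tZ et | seesOnly (Dn (there (∈-++⁺ˡ (∈-++⁺ʳ m1 (here refl))))) tZ et
        ...   | no nzt | tac | oe =
                noEar y0 m1 e (proj₁ (splitPath y0 m1 e m2 y1 ID)) (λ m → Dn (splitPath-∈₁ y0 m1 e m2 y1 m)) zZ tZ y0z et oy0 oe
                  (λ m → seesNothing (nm1 m)) (λ z≡t → pair-≢ tac za zc (esym z≡t)) nzt
        ...   | yes zt | tac | oe
                with scanEar (length m2) e m2 y1 ≤-refl (proj₂ (splitPath y0 m1 e m2 y1 ID)) (λ m → Dn (splitPath-∈₂ y0 m1 e m2 y1 m))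
                       tac tZ et oe y1z' oy1 z'Z z'a z'c (λ m → MI (∈-++⁺ʳ m1 (there m)))
        ...     | z't , al2 = noTent y0 (m1 ++ e ∷ m2) y1 ID Dn tZ zZ z'Z zt z't zz' nzz' y0z y1z' oy0 oy1 all
          where
          all : ∀ {x} → x ∈ m1 ++ e ∷ m2 → SeesOnly x t
          all m ζZ a with ∈-++⁻ m1 m
          ... | inj₁ m' = ⊥-elim (seesNothing (nm1 m') ζZ a)
          ... | inj₂ (here refl) = oe ζZ a
          ... | inj₂ (there m') = al2 m' ζZ a

-- Walks, reachability and the components of a minimal separator.
module Separation (G : Graph) (dAdj : ∀ x y → Dec (Adj G x y)) where
  open Paths G
  open import Data.List.Membership.DecPropositional (_≟_ {n G}) using (_∈?_)

  module _ {R : Subset (n G)} where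
    reach-start : ∀ {x y} → Reach G R x y → x ∉ₛ R
    reach-start (here xn) = xn
    reach-start (step xn _ _) = xn

    reach-end : ∀ {x y} → Reach G R x y → y ∉ₛ R
    reach-end (here xn) = xn
    reach-end (step _ _ r) = reach-end r

    reach-snoc : ∀ {x y w} → Reach G R x y → y ~ w → w ∉ₛ R → Reach G R x w
    reach-snoc (here xn) a wn = step xn a (here wn)
    reach-snoc (step xn a r) b wn = step xn a (reach-snoc r b wn)

    reach-trans : ∀ {x y z} → Reach G R x y → Reach G R y z → Reach G R x z
    reach-trans (here _) r = r
    reach-trans (step xn a r) r' = step xn a (reach-trans r r')

    reach-sym : ∀ {x y} → Reach G R x y → Reach G R y x
    reach-sym (here xn) = here xn
    reach-sym (step xn a r) = reach-snoc (reach-sym r) (~sym a) xn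

  data Wk : V → List V → Set where
    wk0 : ∀ {x} → Wk x []
    wkc : ∀ {x y ys} → x ~ y → Wk y ys → Wk x (y ∷ ys)

  wk-++ : ∀ {x} ws {vs} → Wk x ws → Wk (lastOr x ws) vs → Wk x (ws ++ vs)
  wk-++ [] _ w = w
  wk-++ (y ∷ ws) (wkc a w) w' = wkc a (wk-++ ws w w')

  wk-suf : ∀ {x} p {z q} → Wk x (p ++ z ∷ q) → Wk z q
  wk-suf [] (wkc _ w) = w
  wk-suf (a ∷ p) (wkc _ w) = wk-suf p w

  wk-pre : ∀ {x} p {q} → Wk x (p ++ q) → Wk x p
  wk-pre [] _ = wk0
  wk-pre (a ∷ p) (wkc b w) = wkc b (wk-pre p w)

  wk-pred : ∀ {x} p {y q} → Wk x (p ++ y ∷ q) → lastOr x p ~ y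
  wk-pred [] (wkc a _) = a
  wk-pred (a ∷ p) (wkc _ w) = wk-pred p w

  reach-walk : ∀ {R x y} → Reach G R x y → Σ (List V) λ ws → Wk x ws × lastOr x ws ≡ y × (∀ {z} → z ∈ x ∷ ws → Reach G R z y)
  reach-walk (here xn) = [] , wk0 , refl , λ { (here refl) → here xn }
  reach-walk {x = x} (step xn a r) with reach-walk r
  ... | ws , w , e , al = _ ∷ ws , wkc a w , e , al'
    where
    al' : ∀ {z} → z ∈ x ∷ _ ∷ ws → Reach G _ z _
    al' (here refl) = step xn a r
    al' (there m) = al m

  -- Every walk from x shortcuts to an induced path from x with the same end,
  -- using only vertices of the walk: jump to the last occurrence of x, or
  -- else to the last neighbour of x, and recurse (on the length bound n).
  shortcut : ∀ (n : ℕ) x ws → length ws ≤ n → Wk x ws → Σ (List V) λ os → IP (x ∷ os) × lastOr x os ≡ lastOr x ws × (∀ {z} → z ∈ os → z ∈ ws)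
  shortcut n x [] le w = [] , ip1 x , refl , λ ()
  shortcut zero x (y ∷ ws) () w
  shortcut (suc n) x (y ∷ ws) le w with any? (x ≟_) (y ∷ ws)
  ... | yes a with splitLast (x ≟_) (y ∷ ws) a
  ...   | p , z , q , eq , refl , nq with shortcut n x q (suffix-shorter p x q (subst (λ l → length l ≤ suc n) eq le)) (wk-suf p (subst (Wk x) eq w))
  ...   | os , ip , lo , sub = os , ip , trans lo (esym lo2) , λ m → subst (_ ∈_) (esym eq) (∈-++⁺ʳ p (there (sub m)))
    where
    lo2 : lastOr x (y ∷ ws) ≡ lastOr x q
    lo2 = trans (cong (lastOr x) eq) (lastOr-++ x p (x ∷ q))
  shortcut (suc n) x (y ∷ ws) le (wkc xy w) | no na with splitLast (dAdj x) (y ∷ ws) (here xy)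
  ... | p , z , q , eq , xz , nq with shortcut n z q (suffix-shorter p z q (subst (λ l → length l ≤ suc n) eq le)) (wk-suf p (subst (Wk x) eq (wkc xy w)))
  ... | os , ip , lo , sub = z ∷ os , ipc xz (λ m → nq (sub m)) xn ip , trans lo (esym lo2) , inws
    where
    inws : ∀ {v} → v ∈ z ∷ os → v ∈ y ∷ ws
    inws (here refl) = subst (_ ∈_) (esym eq) (∈-++⁺ʳ p (here refl))
    inws (there m) = subst (_ ∈_) (esym eq) (∈-++⁺ʳ p (there (sub m)))
    xn : x ∉ z ∷ os
    xn m = na (inws m)
    lo2 : lastOr x (y ∷ ws) ≡ lastOr z q
    lo2 = trans (cong (lastOr x) eq) (lastOr-++ x p (z ∷ q))


  module FullComponents {S : Subset (n G)} {s t : V} (sS : s ∉ₛ S) (tS : t ∉ₛ S) (nst : ¬ Reach G S s t)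
              (minl : ∀ R′ → R′ ⊂ₛ S → ¬ IsSeparator G s t R′) where
    enterAt : ∀ {b x} → Reach G S s x → Reach G (S - b) x t → Σ V λ w → Reach G S s w × w ~ b
    enterAt rsx (here _) = ⊥-elim (nst rsx)
    enterAt {b} rsx (step {w = w'} xn a r) with w' ≟ b
    ... | yes refl = _ , rsx , a
    ... | no ne = enterAt (reach-snoc rsx a (λ m → reach-start r (x∈p∧x≢y⇒x∈p-y m ne))) r

    -- Every vertex b of S has a neighbour in the component of s (classically):
    -- otherwise S - b would still separate s from t.
    fullComponent : ∀ {b} → b ∈ₛ S → ¬ ¬ (Σ V λ w → Reach G S s w × w ~ b)
    fullComponent {b} bS noNeighbour = minl (S - b) (x∈p⇒p-x⊂p bS)
      ((λ m → sS (S-b⊆S m)) , (λ m → tS (S-b⊆S m)) , λ r → noNeighbour (enterAt (here sS) r))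
      where
      S-b⊆S : S - b ⊆ₛ S
      S-b⊆S = proj₁ (x∈p⇒p-x⊂p bS)

  module Side (S : Subset (n G)) (s : V) where
    C : V → Set
    C x = Reach G S s x

    record Arc (α γ : V) : Set where
      constructor arc
      field
        inner : List V
        induced : IP (α ∷ inner ++ [ γ ])
        nonEmpty : inner ≢ []
        inComponent : ∀ {x} → x ∈ inner → C x

    -- Non-adjacent α, γ with neighbours in C are joined by such an arc:
    -- shortcut a walk α, w1, …, w2, γ.
    arcThrough : ∀ {α γ w1 w2} → α ≢ γ → ¬ α ~ γ → C w1 → w1 ~ α → C w2 → w2 ~ γ → Arc α γ
    arcThrough {α} {γ} {w1} {w2} αγ nαγ r1 w1α r2 w2γ with reach-walk (reach-trans (reach-sym r1) r2)
    ... | ws , wk , lo , al with shortcut (length (w1 ∷ ws ++ [ γ ])) α (w1 ∷ ws ++ [ γ ]) ≤-refl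
                                 (wkc (~sym w1α) (wk-++ ws wk (subst (λ v → Wk v [ γ ]) (esym lo) (wkc w2γ wk0))))
    ... | os , ip , lo' , sub = res os ip (trans lo' (lastOr-snoc w1 ws γ)) sub
      where
      res : ∀ os → IP (α ∷ os) → lastOr α os ≡ γ → (∀ {z} → z ∈ os → z ∈ w1 ∷ ws ++ [ γ ]) → Arc α γ
      res [] ip e _ = ⊥-elim (αγ e)
      res (o ∷ os) ip e sb with unsnoc o os
      ... | i , eqi = arc i ipU neU CU
        where
        eq' : o ∷ os ≡ i ++ [ γ ]
        eq' = trans eqi (cong (λ v → i ++ [ v ]) e)
        ipU : IP (α ∷ i ++ [ γ ])
        ipU = subst (λ l → IP (α ∷ l)) eq' ip
        neU : i ≢ []
        neU refl = nαγ (ip-head ipU)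
        CU : ∀ {x} → x ∈ i → C x
        CU m with ∈-++⁻ (w1 ∷ ws) (sb (subst (_ ∈_) (esym eq') (∈-++⁺ˡ m)))
        ... | inj₁ m1 = reach-trans r2 (reach-sym (al m1))
        ... | inj₂ (here refl) = ⊥-elim (ip-disj i (ip-tail ipU) m (here refl))

    Q : V → List V → Set
    Q x U = x ∈ U ⊎ Any (x ~_) U

    Q? : ∀ U x → Dec (Q x U)
    Q? U x with x ∈? U | any? (dAdj x) U
    ... | yes m | _ = yes (inj₁ m)
    ... | no _ | yes a = yes (inj₂ a)
    ... | no nm | no na = no λ { (inj₁ m) → nm m ; (inj₂ a) → na a }

    record Approach (β : V) (U : List V) : Set where
      constructor approach
      field
        y z : V
        tu : List V
        induced : IP (β ∷ tu)
        last≡y : lastOr β tu ≡ y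
        z∈U : z ∈ U
        y~z : y ~ z
        inComponent : ∀ {x} → x ∈ tu → C x
        onlyLastSees : ∀ {x} → x ∈ β ∷ tu → x ≢ y → ¬ Any (x ~_) U
        avoids : ∀ {x} → x ∈ β ∷ tu → x ∉ U

    -- A vertex β ∈ S with a neighbour in C approaches any non-empty U ⊆ C:
    -- walk from β into C and on to U, stop at the first vertex that meets or
    -- sees U, and shortcut.
    approachFrom : ∀ {β w} (U : List V) → U ≢ [] → (∀ {x} → x ∈ U → C x) → β ∈ₛ S → C w → w ~ β → Approach β U
    approachFrom [] ne _ _ _ _ = ⊥-elim (ne refl)
    approachFrom {β} {w} (x1 ∷ U') ne CU βS rw wβ with reach-walk (reach-trans (reach-sym rw) (CU (here refl)))
    ... | ws , wk , lo , al with splitFirst (Q? U) (β ∷ w ∷ ws) anyQ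
      where
      U : List V
      U = x1 ∷ U'
      anyQ : Any (λ x → Q x U) (β ∷ w ∷ ws)
      anyQ = there (Any.map (λ e → inj₁ (here (trans (esym e) lo))) (lastOr-∈ w ws))
    ... | [] , y , post , eqL , Qy , npre with ∷-injective eqL
    ...   | refl , _ = body Qy
      where
      U : List V
      U = x1 ∷ U'
      βU : β ∉ U
      βU m = reach-end (CU m) βS
      body : Q β U → Approach β U
      body (inj₁ m) = ⊥-elim (βU m)
      body (inj₂ h) with witness h
      ... | z , zU , yz = approach β z [] (ip1 β) refl zU yz (λ ()) (λ { (here refl) ne' → ⊥-elim (ne' refl) }) λ { (here refl) → βU }
    approachFrom {β} {w} (x1 ∷ U') ne CU βS rw wβ | ws , wk , lo , al | (β' ∷ pre') , y , post , eqL , Qy , npre with ∷-injective eqL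
    ... | refl , eq2 = body Qy
      where
      -- The first vertex y after β meeting or seeing U only sees U (its
      -- predecessor would otherwise see U); shortcut the walk from β to y.
      U : List V
      U = x1 ∷ U'
      WkB : Wk β (pre' ++ y ∷ post)
      WkB = subst (Wk β) eq2 (wkc (~sym wβ) wk)
      pr : lastOr β pre' ~ y
      pr = wk-pred pre' WkB
      yU : y ∉ U
      yU m = npre (lastOr-∈ β pre') (inj₂ (Any.map (λ e → subst (_ ~_) e pr) m))
      inW : ∀ {x} → x ∈ pre' ++ [ y ] → x ∈ w ∷ ws
      inW m with ∈-++⁻ pre' m
      ... | inj₁ m1 = subst (_ ∈_) (esym eq2) (∈-++⁺ˡ m1)
      ... | inj₂ (here refl) = subst (_ ∈_) (esym eq2) (∈-++⁺ʳ pre' (here refl))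
      body : Q y U → Approach β U
      body (inj₁ m) = ⊥-elim (yU m)
      body (inj₂ h) with witness h
      ... | z , zU , yz with shortcut (length (pre' ++ [ y ])) β (pre' ++ [ y ]) ≤-refl (wk-pre (pre' ++ [ y ]) (subst (Wk β) (esym (++-assoc pre' [ y ] post)) WkB))
      ...   | tu , ip , lo' , sub = approach y z tu ip (trans lo' (lastOr-snoc β pre' y)) zU yz
                (λ {x} m → reach-trans (CU (here refl)) (reach-sym (al (inW (sub m))))) nH nU
        where
        nH : ∀ {x} → x ∈ β ∷ tu → x ≢ y → ¬ Any (x ~_) U
        nH (here refl) _ a = npre (here refl) (inj₂ a)
        nH (there m) ne' a with ∈-++⁻ pre' (sub m)
        ... | inj₁ m1 = npre (there m1) (inj₂ a)
        ... | inj₂ (here refl) = ne' refl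
        nU : ∀ {x} → x ∈ β ∷ tu → x ∉ U
        nU (here refl) m = npre (here refl) (inj₁ m)
        nU (there m) m' with ∈-++⁻ pre' (sub m)
        ... | inj₁ m1 = npre (there m1) (inj₁ m')
        ... | inj₂ (here refl) = yU m'

module MinimalSeparator (G : Graph) (dAdj : ∀ x y → Dec (Adj G x y)) (k : ℕ)
  (cycleLength : ∀ zs → Paths.Cyc G zs → length zs ≡ k) (5≤k : 5 ≤ k) (k-odd : ∀ r → k ≢ r + r)
  (S : Subset (n G)) (u v : Fin (n G)) (uS : u ∉ₛ S) (vS : v ∉ₛ S) (nuv : ¬ Reach G S u v)
  (minimal : ∀ R′ → R′ ⊂ₛ S → ¬ IsSeparator G u v R′) where
  open Paths G
  open Separation G dAdj
  open OddCycleGeometry G dAdj k cycleLength 5≤k k-odd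

  module SU = Side S u
  module SV = Side S v

  minimal′ : ∀ R′ → R′ ⊂ₛ S → ¬ IsSeparator G v u R′
  minimal′ R′ sub (vn , un , nr) = minimal R′ sub (un , vn , λ r → nr (reach-sym r))

  fullU : ∀ {b} → b ∈ₛ S → ¬ ¬ (Σ V λ w → Reach G S u w × w ~ b)
  fullU = FullComponents.fullComponent uS vS nuv minimal

  fullV : ∀ {b} → b ∈ₛ S → ¬ ¬ (Σ V λ w → Reach G S v w × w ~ b)
  fullV = FullComponents.fullComponent vS uS (λ r → nuv (reach-sym r)) minimal′

  noEdge : ∀ {x y} → Reach G S u x → Reach G S v y → ¬ x ~ y
  noEdge rx ry a = nuv (reach-trans (reach-snoc rx a (reach-end ry)) (reach-sym ry))

  disj : ∀ {x} → Reach G S u x → Reach G S v x → ⊥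
  disj rx ry = nuv (reach-trans rx (reach-sym ry))

  notS : ∀ {s x a} → Reach G S s x → a ∈ₛ S → x ≢ a
  notS r aS refl = reach-end r aS

  -- The configuration: arcs A (through C_u) and B (through C_v) from α to
  -- γ, which form the induced cycle Z, and approaches from β to them.  The
  -- two approaches, joined at β, form an ear off Z contradicting noPairEar
  -- (or atMostOneNeighbour when the ear is the single vertex β).
  module Configuration {α β γ : V} (αS : α ∈ₛ S) (γS : γ ∈ₛ S)
     (αβ : α ≢ β) (βγ : β ≢ γ) (nαγ : ¬ α ~ γ)
     (A : SU.Arc α γ) (B : SV.Arc α γ)
     (T : SU.Approach β (SU.Arc.inner A)) (T′ : SV.Approach β (SV.Arc.inner B)) where
    open SU.Arc A renaming (inner to U; induced to ipU; nonEmpty to neU; inComponent to CU)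
    open SV.Arc B renaming (inner to W; induced to ipW; nonEmpty to neW; inComponent to CW)
    open SU.Approach T renaming (induced to ipT; last≡y to loT; z∈U to zU; y~z to yz; inComponent to CT;
                                  onlyLastSees to nHT; avoids to nUT)
    open SV.Approach T′ renaming (y to y'; z to z'; tu to tv; induced to ipT'; last≡y to loT'; z∈U to z'W; y~z to y'z';
                                   inComponent to CT'; onlyLastSees to nHT'; avoids to nUT')

    Z : List V
    Z = α ∷ U ++ γ ∷ reverse W

    cZ : Cyc Z
    cZ = cyc2 α U γ W ipU ipW neU neW nαγ (λ m m' → noEdge (CU m) (CW m')) (λ m m' → disj (CU m) (CW m'))

    open AroundCycle Z cZ
    zmem : ∀ {ζ} → ζ ∈ Z → ζ ≡ α ⊎ ζ ∈ U ⊎ ζ ≡ γ ⊎ ζ ∈ W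
    zmem (here e) = inj₁ e
    zmem (there m) with ∈-++⁻ U m
    ... | inj₁ m1 = inj₂ (inj₁ m1)
    ... | inj₂ (here e) = inj₂ (inj₂ (inj₁ e))
    ... | inj₂ (there m2) = inj₂ (inj₂ (inj₂ (∈-reverse⁻ m2)))

    αZ : α ∈ Z
    αZ = here refl
    uZ : ∀ {x} → x ∈ U → x ∈ Z
    uZ m = there (∈-++⁺ˡ m)
    wZ : ∀ {x} → x ∈ W → x ∈ Z
    wZ m = there (∈-++⁺ʳ U (there (∈-reverse⁺ m)))

    offZ : ∀ {x} → x ≢ α → x ≢ γ → x ∉ U → x ∉ W → x ∉ Z
    offZ xa xc xu xw m with zmem m
    ... | inj₁ e = xa e
    ... | inj₂ (inj₁ m1) = xu m1
    ... | inj₂ (inj₂ (inj₁ e)) = xc e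
    ... | inj₂ (inj₂ (inj₂ m2)) = xw m2

    βoff : β ∉ Z
    βoff = offZ (λ e → αβ (esym e)) βγ (nUT (here refl)) (nUT' (here refl))

    tuoff : ∀ {x} → x ∈ tu → x ∉ Z
    tuoff m = offZ (notS (CT m) αS) (notS (CT m) γS) (nUT (there m)) (λ m' → disj (CT m) (CW m'))

    tvoff : ∀ {x} → x ∈ tv → x ∉ Z
    tvoff m = offZ (notS (CT' m) αS) (notS (CT' m) γS) (λ m' → disj (CU m') (CT' m)) (nUT' (there m))

    zZ : z ∈ Z
    zZ = uZ zU
    z'Z : z' ∈ Z
    z'Z = wZ z'W

    E : List V
    E = reverse tu ++ β ∷ tv

    ipRT : IP (reverse tu ++ [ β ])
    ipRT = subst IP (unfold-reverse β tu) (ip-rev _ ipT)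

    ipE : IP E
    ipE = ip-glue (reverse tu) β tv ipRT ipT' (λ m m' → noEdge (CT (∈-reverse⁻ m)) (CT' m')) (λ m m' → disj (CT (∈-reverse⁻ m)) (CT' m'))

    earMembers : ∀ {x} → x ∈ E → x ∈ tu ⊎ x ≡ β ⊎ x ∈ tv
    earMembers m with ∈-++⁻ (reverse tu) m
    ... | inj₁ m1 = inj₁ (∈-reverse⁻ m1)
    ... | inj₂ (here e) = inj₂ (inj₁ e)
    ... | inj₂ (there m2) = inj₂ (inj₂ m2)

    earOffZ : ∀ {x} → x ∈ E → x ∉ Z
    earOffZ m with earMembers m
    ... | inj₁ m1 = tuoff m1
    ... | inj₂ (inj₁ refl) = βoff
    ... | inj₂ (inj₂ m2) = tvoff m2

    seesVia : ∀ {x ζ} {L : List V} → ζ ∈ L → x ~ ζ → Any (x ~_) L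
    seesVia m a = Any.map (λ e → subst (_ ~_) e a) m

    open AvoidingPair α γ nαγ

    -- Apart from its ends y and y', the ear sees Z only in α or γ: a vertex
    -- of tu (or β) seeing U is y, one of tv seeing U would join C_u and C_v.
    earSeesOnlyPair : ∀ {x} → x ∈ E → x ≢ y → x ≢ y' → SeesOnlyPair x
    earSeesOnlyPair {x} m xy xy' {ζ} ζZ a with zmem ζZ
    ... | inj₁ e = inj₁ e
    ... | inj₂ (inj₂ (inj₁ e)) = inj₂ e
    ... | inj₂ (inj₁ mU) with earMembers m
    ...   | inj₁ m1 = ⊥-elim (nHT (there m1) xy (seesVia mU a))
    ...   | inj₂ (inj₁ refl) = ⊥-elim (nHT (here refl) xy (seesVia mU a))
    ...   | inj₂ (inj₂ m2) = ⊥-elim (noEdge (CU mU) (CT' m2) (~sym a))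
    earSeesOnlyPair {x} m xy xy' {ζ} ζZ a | inj₂ (inj₂ (inj₂ mW)) with earMembers m
    ...   | inj₁ m1 = ⊥-elim (noEdge (CT m1) (CW mW) a)
    ...   | inj₂ (inj₁ refl) = ⊥-elim (nHT' (here refl) xy' (seesVia mW a))
    ...   | inj₂ (inj₂ m2) = ⊥-elim (nHT' (there m2) xy' (seesVia mW a))

    zz' : z ≢ z'
    zz' refl = disj (CU zU) (CW z'W)

    earShape : Σ (List V) λ r → E ≡ y ∷ r ++ tv × lastOr y r ≡ β
    earShape with reverse-head β tu
    ... | r , er = r , eqE , lastOr-unique y r (reverse tu) β (esym e1)
      where
      e1 : reverse tu ++ [ β ] ≡ y ∷ r
      e1 = trans (esym (unfold-reverse β tu)) (trans er (cong (_∷ r) loT))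
      eqE : E ≡ y ∷ r ++ tv
      eqE = trans (esym (++-assoc (reverse tu) [ β ] tv)) (cong (_++ tv) e1)

    -- A one-vertex ear β = y = y' would see both z and z'.
    shortEar : ∀ r → E ≡ y ∷ r ++ tv → r ++ tv ≡ [] → ⊥
    shortEar r eqE eR = atMostOneNeighbour βoff zZ z'Z (subst (_~ z) (esym βy) yz) (subst (_~ z') (esym βy') y'z') zz'
      where
      βy : β ≡ y
      βy with subst (β ∈_) (trans eqE (cong (y ∷_) eR)) (∈-++⁺ʳ (reverse tu) (here refl))
      ... | here e = e
      βy' : β ≡ y'
      βy' = trans (esym (cong (lastOr β) (++-conicalʳ r tv eR))) loT'

    longEar : ∀ r o os → E ≡ y ∷ r ++ tv → lastOr y r ≡ β → r ++ tv ≡ o ∷ os → ⊥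
    longEar r o os eqE1 lr eR with unsnoc o os
    ... | mid , em = noPairEar y mid y' ipE' (λ m → earOffZ (subst (_ ∈_) (esym eqE) m)) zZ z'Z yz y'z' zz'
                       (λ a → noEdge (CU zU) (CW z'W) a)
                       (notS (CU zU) αS) (notS (CU zU) γS) (notS (CW z'W) αS) (notS (CW z'W) γS) midSees
      where
      ly : lastOr o os ≡ y'
      ly = trans (cong (lastOr y) (esym eR)) (trans (lastOr-++ y r tv) (trans (cong (λ t → lastOr t tv) lr) loT'))
      eqE : E ≡ y ∷ mid ++ [ y' ]
      eqE = trans eqE1 (cong (y ∷_) (trans eR (trans em (cong (λ t → mid ++ [ t ]) ly))))
      ipE' : IP (y ∷ mid ++ [ y' ])
      ipE' = subst IP eqE ipE
      midSees : ∀ {x} → x ∈ mid → SeesOnlyPair x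
      midSees m = earSeesOnlyPair (subst (_ ∈_) (esym eqE) (there (∈-++⁺ˡ m)))
                    (λ e → ip-notin ipE' (subst (_∈ mid ++ [ y' ]) e (∈-++⁺ˡ m)))
                    (λ e → ip-disj mid (ip-tail ipE') m (here e))

    impossible : ⊥
    impossible with earShape
    ... | r , eqE , lr = byLength (r ++ tv) refl
      where
      byLength : ∀ rest → r ++ tv ≡ rest → ⊥
      byLength [] eR = shortEar r eqE eR
      byLength (o ∷ os) eR = longEar r o os eqE lr eR

  noNonAdjacentTriple : ∀ {α β γ} → α ∈ₛ S → β ∈ₛ S → γ ∈ₛ S → α ≢ β → β ≢ γ → α ≢ γ → ¬ α ~ γ → ⊥
  noNonAdjacentTriple {α} {β} {γ} αS βS γS αβ βγ αγ nαγ =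
    fullU αS λ { (_ , r1 , a1) → fullU γS λ { (_ , r2 , a2) → fullV αS λ { (_ , r3 , a3) → fullV γS λ { (_ , r4 , a4) →
    fullU βS λ { (_ , r5 , a5) → fullV βS λ { (_ , r6 , a6) →
    let A : SU.Arc α γ
        A = SU.arcThrough αγ nαγ r1 a1 r2 a2
        B : SV.Arc α γ
        B = SV.arcThrough αγ nαγ r3 a3 r4 a4
    in Configuration.impossible αS γS αβ βγ nαγ A B
         (SU.approachFrom _ (SU.Arc.nonEmpty A) (SU.Arc.inComponent A) βS r5 a5)
         (SV.approachFrom _ (SV.Arc.nonEmpty B) (SV.Arc.inComponent B) βS r6 a6) } } } } } }

  -- Three distinct vertices of S cannot exist: since G has no triangle, some
  -- two of them are non-adjacent.
  noTriple : ∀ {a b c} → a ∈ₛ S → b ∈ₛ S → c ∈ₛ S → a ≢ b → b ≢ c → a ≢ c → ⊥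
  noTriple {a} {b} {c} aS bS cS a≢b b≢c a≢c with dAdj a c | dAdj a b | dAdj b c
  ... | no a≁c | _ | _ = noNonAdjacentTriple aS bS cS a≢b b≢c a≢c a≁c
  ... | yes _ | no a≁b | _ = noNonAdjacentTriple aS cS bS a≢c (λ e → b≢c (esym e)) a≢b a≁b
  ... | yes _ | yes _ | no b≁c = noNonAdjacentTriple bS aS cS (λ e → a≢b (esym e)) a≢c b≢c b≁c
  ... | yes a~c | yes a~b | yes b~c = noTriangle a~b b~c a~c

¬¬-∀Fin : ∀ {m} (P : Fin m → Set) → (∀ i → ¬ ¬ P i) → ¬ ¬ (∀ i → P i)
¬¬-∀Fin {zero} P h k = k (λ ())
¬¬-∀Fin {suc m} P h k =
  h fzero (λ p0 → ¬¬-∀Fin (λ i → P (fsuc i)) (λ i → h (fsuc i)) (λ ps → k (λ { fzero → p0 ; (fsuc i) → ps i })))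

¬¬-decidableAdjacency : (G : Graph) → ¬ ¬ (∀ x y → Dec (Adj G x y))
¬¬-decidableAdjacency G = ¬¬-∀Fin _ (λ x → ¬¬-∀Fin _ (λ y → ¬¬-excluded-middle))

theorem1 : (m : ℕ) → 1 ≤ m → (G : Graph) → Connected G → SC (2 * m + 3) G →
    (S : Subset (n G)) → IsMinimalVertexSeparator G S → ∣ S ∣ ≤ 2
theorem1 m 1≤m G _ sc S (u , v , _ , _ , (uS , vS , nuv) , minimal) with ∣ S ∣ ≤? 2
... | yes ∣S∣≤2 = ∣S∣≤2
... | no ∣S∣≰2 = ⊥-elim (¬¬-decidableAdjacency G noThreeElements)
  where
  noThreeElements : (∀ x y → Dec (Adj G x y)) → ⊥
  noThreeElements dAdj with threeElements S (≰⇒> ∣S∣≰2)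
  ... | a , b , c , aS , bS , cS , a≢b , b≢c , a≢c = noTriple aS bS cS a≢b b≢c a≢c
    where
    k : ℕ
    k = 2 * m + 3
    open MinimalSeparator G dAdj k (ListCycles.listCycleLength G k sc) (5≤2m+3 m 1≤m) (2m+3-odd m)
                          S u v uS vS nuv minimal
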